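{- Let $m\ge1$, and let $\psi:S_m\times\mathcal{P}([m])\to S_{2m}$ be the map defined below. Then (1) $\psi$ is a bijection onto $\mathcal{W}(S_{2m})$; denote by $\phi_{2m}:\mathcal{W}(S_{2m})\to S_m\times\mathcal{P}([m])$ its inverse. (2) $\phi_{2m}:\mathcal{W}(S_{2m})\to S_m\otimes\mathcal{P}([m])$ is order preserving. (3) $\phi_{2m}^{ -1}=\psi:S_m\times\mathcal{P}([m])\to\mathcal{W}(S_{2m})$ is order preserving, where $S_m\times\mathcal{P}([m])$ carries the product order. Moreover $\ell(v)=4\ell(\tau)+|T|$ whenever $\phi_{2m}(v)=(\tau,T)$.
   Context: $S_k$ is the symmetric group on $[k]$ in one-line notation, $\ell$ the number of inversions, $\leqslant$ Bruhat order; $\mathcal{P}([m])$ is ordered by inclusion. For $i\in[n]$ let $i^*=i-1$ if $i$ even, $i^*=i+1$ if $i$ odd and $i+1\le n$, $i^*=n$ otherwise; $\mathcal{W}(S_n)=\{\sigma\in S_n:|\sigma^{ -1}(i)-\sigma^{ -1}(i^*)|\le1\ \forall i\in[n-1]\}$ with the induced Bruhat order. For $u\in S_m$, $T\subseteq[m]$, $\psi(u,T)=v$ where $v(2i-1)=2u(i)-1$, $v(2i)=2u(i)$ if $i\notin T$, and $v(2i-1)=2u(i)$, $v(2i)=2u(i)-1$ if $i\in T$. The ordinal product $P\otimes Q$ of posets is $P\times Q$ with $(x,y)\le(x',y')$ iff $x<x'$, or $x=x'$ and $y\le y'$. -}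

module Defs where

open import Data.Nat using (ℕ; zero; suc; _+_; _*_; _∸_; _<_; _≤_; _≤?_; ∣_-_∣)
open import Data.Nat.Properties using () renaming (_<?_ to _<ℕ?_)
open import Data.Fin using (Fin; zero; suc; toℕ; combine; remQuot; _<?_)
open import Data.Fin.Properties using (remQuot-combine; combine-remQuot)
open import Data.Fin.Permutation using (Permutation′; permutation; _⟨$⟩ʳ_; _⟨$⟩ˡ_; transpose; inverseˡ; inverseʳ)
open import Data.Fin.Subset using (Subset; _⊆_)
open import Data.Bool using (Bool; true; false; if_then_else_)
open import Data.Vec using (lookup)
open import Data.List using (List; length; filter; cartesianProduct; allFin)
open import Data.Product using (Σ; Σ-syntax; _×_; _,_; proj₁; proj₂; uncurry)
open import Data.Sum using (_⊎_)
open import Relation.Binary.Construct.Closure.Transitive using (TransClosure)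
open import Relation.Nullary using (¬_; does)
open import Relation.Nullary.Decidable using (_×-dec_)
open import Relation.Binary.PropositionalEquality using (_≡_; refl; cong; cong₂; trans; sym)

-- S_k : permutations of [k] = Fin k (0-based: Fin k value a stands for a+1).
-- One-line notation: σ(p) is  σ ⟨$⟩ʳ p.

Perm : ℕ → Set
Perm k = Permutation′ k

_≈ₚ_ : ∀ {k} → Perm k → Perm k → Set
σ ≈ₚ τ = ∀ p → σ ⟨$⟩ʳ p ≡ τ ⟨$⟩ʳ p

ℓ : ∀ {k} → Perm k → ℕ
ℓ {k} σ = length (filter (λ ij → (proj₁ ij <? proj₂ ij) ×-dec ((σ ⟨$⟩ʳ proj₂ ij) <? (σ ⟨$⟩ʳ proj₁ ij)))
                        (cartesianProduct (allFin k) (allFin k)))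

BruhatStep : ∀ {k} → Perm k → Perm k → Set
BruhatStep {k} u v =
  Σ[ i ∈ Fin k ] Σ[ j ∈ Fin k ]
    ((∀ p → v ⟨$⟩ʳ p ≡ u ⟨$⟩ʳ (transpose i j ⟨$⟩ʳ p)) × ℓ u < ℓ v)

_≤B_ : ∀ {k} → Perm k → Perm k → Set
u ≤B v = (u ≈ₚ v) ⊎ TransClosure BruhatStep u v

_<B_ : ∀ {k} → Perm k → Perm k → Set
u <B v = (u ≤B v) × ¬ (u ≈ₚ v)

-- W(S_n).  star n i is the paper's i* (1-based i).

evenℕ : ℕ → Bool
evenℕ zero = true
evenℕ (suc zero) = false
evenℕ (suc (suc x)) = evenℕ x

star : ℕ → ℕ → ℕ
star n i = if evenℕ i then i ∸ 1
           else (if does (suc i ≤? n) then suc i else n)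

-- σ ∈ W(S_n): for all i ∈ [n-1], |σ⁻¹(i) - σ⁻¹(i*)| ≤ 1.
-- a, b : Fin n stand for the (1-based) values suc (toℕ a), suc (toℕ b).
InW : ∀ {n} → Perm n → Set
InW {n} σ = ∀ (a b : Fin n) → suc (toℕ a) < n → suc (toℕ b) ≡ star n (suc (toℕ a)) →
            ∣ toℕ (σ ⟨$⟩ˡ a) - toℕ (σ ⟨$⟩ˡ b) ∣ ≤ 1

-- ψ : S_m × P([m]) → S_{2m}.
-- Position 2i-1 / 2i (1-based) is  combine (i-1) 0 / combine (i-1) 1  in
-- Fin (m * 2); similarly value 2u(i)-1 / 2u(i) is combine (u(i)-1) 0 / 1.

swap₂ : Fin 2 → Fin 2
swap₂ zero = suc zero
swap₂ (suc zero) = zero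

swap₂-inv : ∀ r → swap₂ (swap₂ r) ≡ r
swap₂-inv zero = refl
swap₂-inv (suc zero) = refl

tw : ∀ {m} → Subset m → Fin m → Fin 2 → Fin 2
tw T i r = if lookup T i then swap₂ r else r

tw-inv : ∀ {m} (T : Subset m) i r → tw T i (tw T i r) ≡ r
tw-inv T i r with lookup T i
... | true = swap₂-inv r
... | false = refl

ψ : ∀ {m} → Perm m → Subset m → Perm (m * 2)
ψ {m} u T = permutation f g fg gf
  where
    F : Fin m × Fin 2 → Fin (m * 2)
    F (i , r) = combine (u ⟨$⟩ʳ i) (tw T i r)
    G : Fin m × Fin 2 → Fin (m * 2)
    G (j , s) = combine (u ⟨$⟩ˡ j) (tw T (u ⟨$⟩ˡ j) s)
    f : Fin (m * 2) → Fin (m * 2)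
    f p = F (remQuot 2 p)
    g : Fin (m * 2) → Fin (m * 2)
    g w = G (remQuot 2 w)
    FG : ∀ x → F (remQuot 2 (G x)) ≡ uncurry combine x
    FG (j , s) = trans (cong F (remQuot-combine {m} {2} (u ⟨$⟩ˡ j) (tw T (u ⟨$⟩ˡ j) s)))
                       (cong₂ combine (inverseʳ u {j}) (tw-inv T (u ⟨$⟩ˡ j) s))
    GF : ∀ x → G (remQuot 2 (F x)) ≡ uncurry combine x
    GF (i , r) = trans (cong G (remQuot-combine {m} {2} (u ⟨$⟩ʳ i) (tw T i r)))
                       (cong₂ combine (inverseˡ u {i}) (trans (cong (λ a → tw T a (tw T i r)) (inverseˡ u {i})) (tw-inv T i r)))
    fg : ∀ w → f (g w) ≡ w
    fg w = trans (FG (remQuot 2 w)) (combine-remQuot {m} 2 w)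
    gf : ∀ p → g (f p) ≡ p
    gf p = trans (GF (remQuot 2 p)) (combine-remQuot {m} 2 p)

_≤×_ : ∀ {m} → (Perm m × Subset m) → (Perm m × Subset m) → Set
(u , T) ≤× (u' , T') = (u ≤B u') × (T ⊆ T')

_≤⊗_ : ∀ {m} → (Perm m × Subset m) → (Perm m × Subset m) → Set
(u , T) ≤⊗ (u' , T') = (u <B u') ⊎ ((u ≈ₚ u') × (T ⊆ T'))

-- For a permutation w let rank w a b be the number of positions i < a with b ≤ w i. The Bruhat
-- order is characterised by u ≤ v iff rank u ≤ rank v pointwise: a Bruhat step moves a larger value
-- to an earlier position, which lowers no rank; conversely, if rank u ≤ rank v and u ≠ v, exchanging
-- the value at the first difference p with the first later value lying in (u p, v p] keeps the
-- domination, raises the length, and strictly raises the total of all ranks, which is bounded by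
-- that of v.
--
-- A permutation in W(S_{2m}) puts the two values 2j-1, 2j in adjacent positions; these pairs tile
-- [2m], so each occupies a block of positions {2i-1, 2i}, which identifies W(S_{2m}) with
-- S_m × P([m]) through ψ. On even rows the ranks of ψ(u, T) are sums of two ranks of u, and on odd
-- rows one indicator read off T is added; comparing them gives both monotonicity statements.
-- Counting the inversions of ψ(u, T) block by block gives ℓ = 4ℓ(u) + |T|.

module Submission where

open import Defs
open import Data.Nat using (ℕ; zero; suc; _+_; _*_; _∸_; _<_; _≤_; z≤n; s≤s; _<ᵇ_; _<?_; _≤?_; ∣_-_∣)
open import Data.Nat.Properties
open import Data.Nat.Solver using (module +-*-Solver)
open import Data.Fin using (Fin; Fin′; zero; suc; toℕ; punchIn; inject; inject₁; fromℕ<; combine)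
  renaming (_≟_ to _≟ᶠ_; _<?_ to _<ᶠ?_)
open import Data.Fin.Properties using (punchInᵢ≢i; toℕ-injective; toℕ-inject; toℕ-inject₁; toℕ-fromℕ<; toℕ-↑ˡ; toℕ-↑ʳ;
  toℕ<n; remQuot-combine; combine-injective; combine-surjective; ¬∀⟶∃¬-smallest; all?)
open import Data.Fin.Permutation using (permutation; _⟨$⟩ʳ_; _⟨$⟩ˡ_; transpose; inverseˡ; inverseʳ; _∘ₚ_)
open import Data.Fin.Subset using (Subset; ∣_∣; _⊆_)
open import Data.Vec using ([]; _∷_; lookup; tabulate)
open import Data.Vec.Properties using (tabulate∘lookup; tabulate-cong; lookup∘tabulate; []=⇒lookup; lookup⇒[]=)
open import Data.Bool using (Bool; true; false; _∧_; if_then_else_)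
import Data.List as List
open import Data.List.Properties using (length-++; filter-++; map-tabulate)
open import Data.Product using (Σ-syntax; ∃₂; _×_; _,_; proj₁; proj₂)
open import Data.Sum using (_⊎_; inj₁; inj₂)
open import Data.Unit using (tt)
open import Data.Empty using (⊥; ⊥-elim)
open import Function using (_∘_)
open import Function.Bundles using (Injection)
open import Function.Properties.Inverse using (↔⇒↣)
open import Level using (0ℓ)
open import Relation.Nullary using (¬_; ¬?; Dec; yes; no; does)
open import Relation.Nullary.Decidable using (_×-dec_; decidable-stable; dec-true)
open import Relation.Unary using (Pred; Decidable)
open import Relation.Binary using (tri<; tri≈; tri>)
open import Relation.Binary.PropositionalEquality
open import Relation.Binary.Construct.Closure.Transitive using (TransClosure; [_]; _∷_)
open import Algebra.Properties.Semiring.Sum +-*-semiring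

private variable
  k m : ℕ

𝟙 : Bool → ℕ
𝟙 true = 1
𝟙 false = 0

𝟙-∧ : ∀ x y → 𝟙 (x ∧ y) ≡ 𝟙 x * 𝟙 y
𝟙-∧ true y = sym (+-identityʳ (𝟙 y))
𝟙-∧ false y = refl

𝟙-mono : ∀ {x y} → (x ≡ true → y ≡ true) → 𝟙 x ≤ 𝟙 y
𝟙-mono {false} _ = z≤n
𝟙-mono {true} x⇒y rewrite x⇒y refl = s≤s z≤n

⟦_<_⟧ : ℕ → ℕ → ℕ
⟦ a < b ⟧ = 𝟙 (a <ᵇ b)

<⇒⟦<⟧≡1 : ∀ {a b} → a < b → ⟦ a < b ⟧ ≡ 1
<⇒⟦<⟧≡1 {zero} {suc b} _ = refl
<⇒⟦<⟧≡1 {suc a} {suc b} (s≤s a<b) = <⇒⟦<⟧≡1 a<b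

≥⇒⟦<⟧≡0 : ∀ {a b} → b ≤ a → ⟦ a < b ⟧ ≡ 0
≥⇒⟦<⟧≡0 {a} {zero} _ = refl
≥⇒⟦<⟧≡0 {suc a} {suc b} (s≤s b≤a) = ≥⇒⟦<⟧≡0 b≤a

⟦<⟧-irrefl : ∀ a → ⟦ a < a ⟧ ≡ 0
⟦<⟧-irrefl a = ≥⇒⟦<⟧≡0 (≤-refl {a})

⟦<⟧≡1⇒< : ∀ {a b} → ⟦ a < b ⟧ ≡ 1 → a < b
⟦<⟧≡1⇒< {zero} {suc b} _ = s≤s z≤n
⟦<⟧≡1⇒< {suc a} {suc b} e = s≤s (⟦<⟧≡1⇒< e)

⟦<⟧≡0⇒≥ : ∀ {a b} → ⟦ a < b ⟧ ≡ 0 → b ≤ a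
⟦<⟧≡0⇒≥ {a} {zero} _ = z≤n
⟦<⟧≡0⇒≥ {suc a} {suc b} e = s≤s (⟦<⟧≡0⇒≥ e)

⟦<suc⟧-≢ : ∀ {a b} → a ≢ b → ⟦ a < suc b ⟧ ≡ ⟦ a < b ⟧
⟦<suc⟧-≢ {zero} {zero} 0≢0 = ⊥-elim (0≢0 refl)
⟦<suc⟧-≢ {zero} {suc b} _ = refl
⟦<suc⟧-≢ {suc a} {zero} _ = refl
⟦<suc⟧-≢ {suc a} {suc b} a≢b = ⟦<suc⟧-≢ (a≢b ∘ cong suc)

⟦≤⟧-split : ∀ {b c} x → b ≤ c → ⟦ b < suc x ⟧ ≡ ⟦ c < suc x ⟧ + ⟦ b < suc x ⟧ * ⟦ x < c ⟧
⟦≤⟧-split {b} {c} x b≤c with <-cmp x c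
... | tri< x<c _ _ rewrite ≥⇒⟦<⟧≡0 x<c | <⇒⟦<⟧≡1 x<c = sym (*-identityʳ ⟦ b < suc x ⟧)
... | tri≈ _ refl _ rewrite ⟦<⟧-irrefl x | <⇒⟦<⟧≡1 (s≤s b≤c) | <⇒⟦<⟧≡1 (n<1+n x) = refl
... | tri> _ _ c<x rewrite ≥⇒⟦<⟧≡0 (<⇒≤ c<x) | <⇒⟦<⟧≡1 (s≤s (<⇒≤ c<x)) | <⇒⟦<⟧≡1 (s≤s (≤-trans b≤c (<⇒≤ c<x))) = refl

-- The order 0 ≤ 1 on bits: inequalities between indicators are checked by enumerating bit patterns.
data _⊑_ : ℕ → ℕ → Set where
  0⊑0 : 0 ⊑ 0
  0⊑1 : 0 ⊑ 1
  1⊑1 : 1 ⊑ 1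

⊑⇒≤ : ∀ {x y} → x ⊑ y → x ≤ y
⊑⇒≤ 0⊑0 = z≤n
⊑⇒≤ 0⊑1 = z≤n
⊑⇒≤ 1⊑1 = s≤s z≤n

0⊑⟦<⟧ : ∀ a b → 0 ⊑ ⟦ a < b ⟧
0⊑⟦<⟧ a zero = 0⊑0
0⊑⟦<⟧ zero (suc b) = 0⊑1
0⊑⟦<⟧ (suc a) (suc b) = 0⊑⟦<⟧ a b

⟦<⟧⊑1 : ∀ a b → ⟦ a < b ⟧ ⊑ 1
⟦<⟧⊑1 a zero = 0⊑1
⟦<⟧⊑1 zero (suc b) = 1⊑1
⟦<⟧⊑1 (suc a) (suc b) = ⟦<⟧⊑1 a b

⟦<⟧-monoʳ : ∀ {a x y} → x ≤ y → ⟦ a < x ⟧ ⊑ ⟦ a < y ⟧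
⟦<⟧-monoʳ {a} {zero} {y} _ = 0⊑⟦<⟧ a y
⟦<⟧-monoʳ {zero} {suc x} {suc y} _ = 1⊑1
⟦<⟧-monoʳ {suc a} {suc x} {suc y} (s≤s x≤y) = ⟦<⟧-monoʳ {a} x≤y

⟦<⟧-antiˡ : ∀ {a x y} → x ≤ y → ⟦ y < a ⟧ ⊑ ⟦ x < a ⟧
⟦<⟧-antiˡ {zero} _ = 0⊑0
⟦<⟧-antiˡ {suc a} {zero} {y} _ = ⟦<⟧⊑1 y (suc a)
⟦<⟧-antiˡ {suc a} {suc x} {suc y} (s≤s x≤y) = ⟦<⟧-antiˡ {a} x≤y

+-mono-≤-split₁₃ : ∀ {a b c a′ b′ c′} → a + c ≤ a′ + c′ → b ≤ b′ → a + b + c ≤ a′ + b′ + c′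
+-mono-≤-split₁₃ {a} {b} {c} {a′} {b′} {c′} ac≤ b≤ = begin
  a + b + c      ≡⟨ +-assoc a b c ⟩
  a + (b + c)    ≡⟨ cong (a +_) (+-comm b c) ⟩
  a + (c + b)    ≡⟨ +-assoc a c b ⟨
  a + c + b      ≤⟨ +-mono-≤ ac≤ b≤ ⟩
  a′ + c′ + b′   ≡⟨ +-assoc a′ c′ b′ ⟩
  a′ + (c′ + b′) ≡⟨ cong (a′ +_) (+-comm c′ b′) ⟩
  a′ + (b′ + c′) ≡⟨ +-assoc a′ b′ c′ ⟨
  a′ + b′ + c′   ∎
  where open ≤-Reasoning

+-mono-≤-split₁₂₃ : ∀ {a b c a′ b′ c′} → a ≤ a′ → b + c ≤ b′ + c′ → a + b + c ≤ a′ + b′ + c′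
+-mono-≤-split₁₂₃ {a} {b} {c} {a′} {b′} {c′} a≤ bc≤ =
  subst₂ _≤_ (sym (+-assoc a b c)) (sym (+-assoc a′ b′ c′)) (+-mono-≤ a≤ bc≤)

m+m≤n+n⇒m≤n : ∀ {m n} → m + m ≤ n + n → m ≤ n
m+m≤n+n⇒m≤n m+m≤n+n = ≮⇒≥ (λ n<m → <⇒≱ (+-mono-< n<m n<m) m+m≤n+n)

∣-∣≤1⇒adjacent : ∀ a t → ∣ a - t ∣ ≤ 1 → t ≢ a → t ≡ suc a ⊎ suc t ≡ a
∣-∣≤1⇒adjacent a t d≤1 t≢a with <-cmp t a
... | tri≈ _ t≡a _ = ⊥-elim (t≢a t≡a)
... | tri< t<a _ _ = inj₂ (≤-antisym t<a (begin
  a               ≤⟨ m≤n+m∸n a t ⟩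
  t + (a ∸ t)     ≡⟨ cong (t +_) (m≤n⇒∣n-m∣≡n∸m (<⇒≤ t<a)) ⟨
  t + ∣ a - t ∣   ≤⟨ +-monoʳ-≤ t d≤1 ⟩
  t + 1           ≡⟨ +-comm t 1 ⟩
  suc t           ∎))
  where open ≤-Reasoning
... | tri> _ _ a<t = inj₁ (≤-antisym (begin
  t               ≤⟨ m≤n+m∸n t a ⟩
  a + (t ∸ a)     ≡⟨ cong (a +_) (trans (∣-∣-comm a t) (m≤n⇒∣n-m∣≡n∸m (<⇒≤ a<t))) ⟨
  a + ∣ a - t ∣   ≤⟨ +-monoʳ-≤ a d≤1 ⟩
  a + 1           ≡⟨ +-comm a 1 ⟩
  suc a           ∎) a<t)
  where open ≤-Reasoning

sum-mono-≤ : ∀ {k} {f g : Fin k → ℕ} → (∀ i → f i ≤ g i) → sum f ≤ sum g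
sum-mono-≤ {zero} f≤g = z≤n
sum-mono-≤ {suc k} f≤g = +-mono-≤ (f≤g zero) (sum-mono-≤ (λ i → f≤g (suc i)))

sum-mono-< : ∀ {k} {f g : Fin k → ℕ} (p : Fin k) → (∀ i → f i ≤ g i) → f p < g p → sum f < sum g
sum-mono-< {suc k} {f} {g} p f≤g fp<gp = begin-strict
  sum f                        ≡⟨ sum-remove {i = p} f ⟩
  f p + sum (λ j → f (punchIn p j)) <⟨ +-mono-<-≤ fp<gp (sum-mono-≤ (λ j → f≤g (punchIn p j))) ⟩
  g p + sum (λ j → g (punchIn p j)) ≡⟨ sum-remove {i = p} g ⟨
  sum g                        ∎
  where open ≤-Reasoning

zeroAt : Fin k → (Fin k → ℕ) → Fin k → ℕ
zeroAt p f j with j ≟ᶠ p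
... | yes _ = 0
... | no _ = f j

zeroAt-≢ : ∀ {p j : Fin k} (f : Fin k → ℕ) → j ≢ p → zeroAt p f j ≡ f j
zeroAt-≢ {p = p} {j} f j≢p with j ≟ᶠ p
... | yes j≡p = ⊥-elim (j≢p j≡p)
... | no _ = refl

zeroAt-self : ∀ (p : Fin k) (f : Fin k → ℕ) → zeroAt p f p ≡ 0
zeroAt-self p f with p ≟ᶠ p
... | yes _ = refl
... | no p≢p = ⊥-elim (p≢p refl)

zeroAt-cong : ∀ (p : Fin k) {f g : Fin k → ℕ} → (∀ j → j ≢ p → f j ≡ g j) → ∀ j → zeroAt p f j ≡ zeroAt p g j
zeroAt-cong p f≡g j with j ≟ᶠ p
... | yes _ = refl
... | no j≢p = f≡g j j≢p

zeroAt-+ : ∀ (p : Fin k) (f g : Fin k → ℕ) j → zeroAt p (λ i → f i + g i) j ≡ zeroAt p f j + zeroAt p g j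
zeroAt-+ p f g j with j ≟ᶠ p
... | yes _ = refl
... | no _ = refl

sum-zeroAt : ∀ (p : Fin k) (f : Fin k → ℕ) → sum f ≡ f p + sum (zeroAt p f)
sum-zeroAt {suc k} p f = begin
  sum f                                        ≡⟨ sum-remove {i = p} f ⟩
  f p + sum (λ j → f (punchIn p j))            ≡⟨ cong (f p +_) (sum-cong-≗ (λ j → sym (zeroAt-≢ f (punchInᵢ≢i p j)))) ⟩
  f p + sum (λ j → zeroAt p f (punchIn p j))   ≡⟨ cong (λ z → f p + (z + sum (λ j → zeroAt p f (punchIn p j)))) (zeroAt-self p f) ⟨
  f p + (zeroAt p f p + sum (λ j → zeroAt p f (punchIn p j))) ≡⟨ cong (f p +_) (sum-remove {i = p} (zeroAt p f)) ⟨
  f p + sum (zeroAt p f)                       ∎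
  where open ≡-Reasoning

zeroAt₂ : Fin k → Fin k → (Fin k → ℕ) → Fin k → ℕ
zeroAt₂ p q f = zeroAt q (zeroAt p f)

sum-zeroAt₂ : ∀ {p q : Fin k} → q ≢ p → (f : Fin k → ℕ) → sum f ≡ f p + f q + sum (zeroAt₂ p q f)
sum-zeroAt₂ {p = p} {q} q≢p f = begin
  sum f                                          ≡⟨ sum-zeroAt p f ⟩
  f p + sum (zeroAt p f)                         ≡⟨ cong (f p +_) (sum-zeroAt q (zeroAt p f)) ⟩
  f p + (zeroAt p f q + sum (zeroAt₂ p q f))     ≡⟨ cong (λ z → f p + (z + sum (zeroAt₂ p q f))) (zeroAt-≢ f q≢p) ⟩
  f p + (f q + sum (zeroAt₂ p q f))              ≡⟨ +-assoc (f p) (f q) _ ⟨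
  f p + f q + sum (zeroAt₂ p q f)                ∎
  where open ≡-Reasoning

zeroAt₂-+ : ∀ (p q : Fin k) (f g : Fin k → ℕ) j →
  zeroAt₂ p q (λ i → f i + g i) j ≡ zeroAt₂ p q f j + zeroAt₂ p q g j
zeroAt₂-+ p q f g j with j ≟ᶠ q
... | yes _ = refl
... | no _ = zeroAt-+ p f g j

zeroAt₂-mono : ∀ (p q : Fin k) {f g : Fin k → ℕ} → (∀ j → j ≢ p → j ≢ q → f j ≤ g j) →
  ∀ j → zeroAt₂ p q f j ≤ zeroAt₂ p q g j
zeroAt₂-mono p q f≤g j with j ≟ᶠ q
... | yes _ = z≤n
... | no j≢q with j ≟ᶠ p
...   | yes _ = z≤n
...   | no j≢p = f≤g j j≢p j≢q

zeroAt₂-cong : ∀ (p q : Fin k) {f g : Fin k → ℕ} → (∀ j → j ≢ p → j ≢ q → f j ≡ g j) →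
  ∀ j → zeroAt₂ p q f j ≡ zeroAt₂ p q g j
zeroAt₂-cong p q f≡g j with j ≟ᶠ q
... | yes _ = refl
... | no j≢q with j ≟ᶠ p
...   | yes _ = refl
...   | no j≢p = f≡g j j≢p j≢q

module _ (p q : Fin k) (D : Fin k → Fin k → ℕ) where

  corner : ℕ
  corner = D p p + D p q + (D q p + D q q)

  cross : Fin k → ℕ
  cross x = (D p x + D q x) + (D x p + D x q)

  interior : ℕ
  interior = sum (zeroAt₂ p q (λ i → sum (zeroAt₂ p q (D i))))

∑∑-split : ∀ {p q : Fin k} → q ≢ p → (D : Fin k → Fin k → ℕ) →
  ∑[ i < k ] sum (D i) ≡ corner p q D + sum (zeroAt₂ p q (cross p q D)) + interior p q D
∑∑-split {k} {p} {q} q≢p D = begin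
  sum R                                            ≡⟨ sum-zeroAt₂ q≢p R ⟩
  R p + R q + sum (zeroAt₂ p q R)                  ≡⟨ cong₂ (λ x y → x + y + sum (zeroAt₂ p q R)) (sum-zeroAt₂ q≢p (D p)) (sum-zeroAt₂ q≢p (D q)) ⟩
  (a + b + c) + (d + e + f) + sum (zeroAt₂ p q R)  ≡⟨ cong ((a + b + c) + (d + e + f) +_) rows ⟩
  (a + b + c) + (d + e + f) + (g + h)              ≡⟨ solve 8 (λ a b c d e f g h → (a :+ b :+ c) :+ (d :+ e :+ f) :+ (g :+ h) := (a :+ b :+ (d :+ e)) :+ (c :+ f :+ g) :+ h) refl a b c d e f g h ⟩
  (a + b + (d + e)) + (c + f + g) + h              ≡⟨ cong (λ z → corner p q D + z + h) crosses ⟨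
  corner p q D + sum (zeroAt₂ p q (cross p q D)) + h ∎
  where
  open ≡-Reasoning
  open +-*-Solver using (solve; _:+_; _:=_)
  R : Fin k → ℕ
  R i = sum (D i)
  column : Fin k → ℕ
  column i = D i p + D i q
  a = D p p
  b = D p q
  c = sum (zeroAt₂ p q (D p))
  d = D q p
  e = D q q
  f = sum (zeroAt₂ p q (D q))
  g = sum (zeroAt₂ p q column)
  h = interior p q D
  rows : sum (zeroAt₂ p q R) ≡ g + h
  rows = begin
    sum (zeroAt₂ p q R)                                                     ≡⟨ sum-cong-≗ {k} (λ j →
      trans (zeroAt₂-cong p q (λ i _ _ → sum-zeroAt₂ q≢p (D i)) j) (zeroAt₂-+ p q column _ j)) ⟩
    sum (λ j → zeroAt₂ p q column j + zeroAt₂ p q (λ i → sum (zeroAt₂ p q (D i))) j) ≡⟨ ∑-distrib-+ {k} _ _ ⟩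
    g + h                                                                    ∎
  crosses : sum (zeroAt₂ p q (cross p q D)) ≡ c + f + g
  crosses = begin
    sum (zeroAt₂ p q (cross p q D))            ≡⟨ sum-cong-≗ {k} (λ j →
      trans (zeroAt₂-+ p q _ column j) (cong (_+ zeroAt₂ p q column j) (zeroAt₂-+ p q (D p) (D q) j))) ⟩
    sum (λ j → zeroAt₂ p q (D p) j + zeroAt₂ p q (D q) j + zeroAt₂ p q column j) ≡⟨ ∑-distrib-+ {k} _ _ ⟩
    sum (λ j → zeroAt₂ p q (D p) j + zeroAt₂ p q (D q) j) + g ≡⟨ cong (_+ g) (∑-distrib-+ {k} _ _) ⟩
    c + f + g                                  ∎

∑∑-mono-< : ∀ {p q : Fin k} → q ≢ p → (D D′ : Fin k → Fin k → ℕ) →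
  corner p q D < corner p q D′ →
  (∀ x → x ≢ p → x ≢ q → cross p q D x ≤ cross p q D′ x) →
  (∀ i j → i ≢ p → i ≢ q → j ≢ p → j ≢ q → D i j ≤ D′ i j) →
  ∑[ i < k ] sum (D i) < ∑[ i < k ] sum (D′ i)
∑∑-mono-< {k} {p} {q} q≢p D D′ corner< cross≤ interior≤ = begin-strict
  ∑[ i < k ] sum (D i)                                                  ≡⟨ ∑∑-split q≢p D ⟩
  corner p q D + sum (zeroAt₂ p q (cross p q D)) + interior p q D        <⟨ +-mono-<-≤ (+-mono-<-≤ corner< crosses≤) interiors≤ ⟩
  corner p q D′ + sum (zeroAt₂ p q (cross p q D′)) + interior p q D′     ≡⟨ ∑∑-split q≢p D′ ⟨
  ∑[ i < k ] sum (D′ i)                                                 ∎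
  where
  open ≤-Reasoning
  crosses≤ = sum-mono-≤ (zeroAt₂-mono p q cross≤)
  interiors≤ = sum-mono-≤ (zeroAt₂-mono p q (λ i i≢p i≢q →
                 sum-mono-≤ (zeroAt₂-mono p q (λ j j≢p j≢q → interior≤ i j i≢p i≢q j≢p j≢q))))

perm-injective : ∀ (w : Perm k) {x y} → w ⟨$⟩ʳ x ≡ w ⟨$⟩ʳ y → x ≡ y
perm-injective w = Injection.injective (↔⇒↣ w)

val : Perm k → Fin k → ℕ
val w i = toℕ (w ⟨$⟩ʳ i)

inversions : Perm k → ℕ
inversions {k} w = ∑[ i < k ] ∑[ j < k ] (⟦ toℕ i < toℕ j ⟧ * ⟦ val w j < val w i ⟧)

length-filter-tabulate : ∀ {A : Set} {P : Pred A 0ℓ} (P? : Decidable P) (f : Fin k → A) →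
  List.length (List.filter P? (List.tabulate f)) ≡ ∑[ i < k ] 𝟙 (does (P? (f i)))
length-filter-tabulate {zero} P? f = refl
length-filter-tabulate {suc k} P? f with does (P? (f zero))
... | true = cong suc (length-filter-tabulate P? (f ∘ suc))
... | false = length-filter-tabulate P? (f ∘ suc)

length-filter-cartesianProduct : ∀ {A B : Set} {P : Pred (A × B) 0ℓ} (P? : Decidable P) (f : Fin k → A) (ys : List.List B) →
  List.length (List.filter P? (List.cartesianProduct (List.tabulate f) ys))
    ≡ ∑[ i < k ] List.length (List.filter P? (List.map (f i ,_) ys))
length-filter-cartesianProduct {zero} P? f ys = refl
length-filter-cartesianProduct {suc k} P? f ys = begin
  List.length (List.filter P? (here List.++ rest))                 ≡⟨ cong List.length (filter-++ P? here rest) ⟩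
  List.length (List.filter P? here List.++ List.filter P? rest)    ≡⟨ length-++ (List.filter P? here) ⟩
  List.length (List.filter P? here) + List.length (List.filter P? rest)
    ≡⟨ cong (List.length (List.filter P? here) +_) (length-filter-cartesianProduct P? (f ∘ suc) ys) ⟩
  ∑[ i < suc k ] List.length (List.filter P? (List.map (f i ,_) ys)) ∎
  where
  open ≡-Reasoning
  here = List.map (f zero ,_) ys
  rest = List.cartesianProduct (List.tabulate (f ∘ suc)) ys

ℓ≡inversions : (w : Perm k) → ℓ w ≡ inversions w
ℓ≡inversions {k} w = begin
  ℓ w                                                          ≡⟨ length-filter-cartesianProduct P? (λ i → i) (List.allFin k) ⟩
  (∑[ i < k ] List.length (List.filter P? (List.map (i ,_) (List.allFin k))))   ≡⟨ sum-cong-≗ {k} (λ i →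
    trans (cong (List.length ∘ List.filter P?) (map-tabulate (λ j → j) (i ,_))) (length-filter-tabulate P? (i ,_))) ⟩
  (∑[ i < k ] ∑[ j < k ] 𝟙 (does (P? (i , j))))                ≡⟨ sum-cong-≗ {k} (λ i → sum-cong-≗ {k} (λ j → 𝟙-∧ (does (i <ᶠ? j)) (does ((w ⟨$⟩ʳ j) <ᶠ? (w ⟨$⟩ʳ i))))) ⟩
  inversions w                                                 ∎
  where
  open ≡-Reasoning
  P? = λ (ij : Fin k × Fin k) → (proj₁ ij <ᶠ? proj₂ ij) ×-dec ((w ⟨$⟩ʳ proj₂ ij) <ᶠ? (w ⟨$⟩ʳ proj₁ ij))

ℓ-cong : ∀ {u v : Perm k} → u ≈ₚ v → ℓ u ≡ ℓ v
ℓ-cong {u = u} {v} u≈v = begin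
  ℓ u           ≡⟨ ℓ≡inversions u ⟩
  inversions u  ≡⟨ sum-cong-≗ (λ i → sum-cong-≗ (λ j → cong₂ (λ x y → ⟦ toℕ i < toℕ j ⟧ * ⟦ toℕ x < toℕ y ⟧) (u≈v j) (u≈v i))) ⟩
  inversions v  ≡⟨ ℓ≡inversions v ⟨
  ℓ v           ∎
  where open ≡-Reasoning

record SwapAt {k} (p q : Fin k) (w w′ : Perm k) : Set where
  field
    at-p : w′ ⟨$⟩ʳ p ≡ w ⟨$⟩ʳ q
    at-q : w′ ⟨$⟩ʳ q ≡ w ⟨$⟩ʳ p
    elsewhere : ∀ {x} → x ≢ p → x ≢ q → w′ ⟨$⟩ʳ x ≡ w ⟨$⟩ʳ x

transpose-SwapAt : ∀ {p q : Fin k} {u v : Perm k} → (∀ x → v ⟨$⟩ʳ x ≡ u ⟨$⟩ʳ (transpose p q ⟨$⟩ʳ x)) → SwapAt p q u v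
transpose-SwapAt {p = p} {q} {u} {v} v≡u∘t = record
  { at-p = trans (v≡u∘t p) (cong (u ⟨$⟩ʳ_) transpose-p)
  ; at-q = trans (v≡u∘t q) (cong (u ⟨$⟩ʳ_) transpose-q)
  ; elsewhere = λ x≢p x≢q → trans (v≡u∘t _) (cong (u ⟨$⟩ʳ_) (transpose-other x≢p x≢q))
  }
  where
  transpose-p : transpose p q ⟨$⟩ʳ p ≡ q
  transpose-p with p ≟ᶠ p
  ... | yes _ = refl
  ... | no p≢p = ⊥-elim (p≢p refl)
  transpose-q : transpose p q ⟨$⟩ʳ q ≡ p
  transpose-q with q ≟ᶠ p
  ... | yes q≡p = q≡p
  ... | no _ with q ≟ᶠ q
  ...   | yes _ = refl
  ...   | no q≢q = ⊥-elim (q≢q refl)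
  transpose-other : ∀ {x} → x ≢ p → x ≢ q → transpose p q ⟨$⟩ʳ x ≡ x
  transpose-other {x} x≢p x≢q with x ≟ᶠ p
  ... | yes x≡p = ⊥-elim (x≢p x≡p)
  ... | no _ with x ≟ᶠ q
  ...   | yes x≡q = ⊥-elim (x≢q x≡q)
  ...   | no _ = refl

SwapAt-comm : ∀ {p q : Fin k} {u v : Perm k} → SwapAt p q u v → SwapAt q p u v
SwapAt-comm s = record { at-p = at-q ; at-q = at-p ; elsewhere = λ x≢q x≢p → elsewhere x≢p x≢q }
  where open SwapAt s

SwapAt-sym : ∀ {p q : Fin k} {u v : Perm k} → SwapAt p q u v → SwapAt p q v u
SwapAt-sym s = record { at-p = sym at-q ; at-q = sym at-p ; elsewhere = λ x≢p x≢q → sym (elsewhere x≢p x≢q) }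
  where open SwapAt s

SwapAt-refl⇒≈ : ∀ {p : Fin k} {u v : Perm k} → SwapAt p p u v → v ≈ₚ u
SwapAt-refl⇒≈ {p = p} s x with x ≟ᶠ p
... | yes refl = at-p
  where open SwapAt s
... | no x≢p = elsewhere x≢p x≢p
  where open SwapAt s

-- The position of c relative to a < b, recorded by the four indicators
-- ⟦ a < c ⟧, ⟦ b < c ⟧, ⟦ c < a ⟧, ⟦ c < b ⟧.
data Side : ℕ → ℕ → ℕ → ℕ → Set where
  below : Side 0 0 1 1
  inside : Side 1 0 0 1
  above : Side 1 1 0 0

side : ∀ {a b c} → a < b → c ≢ a → c ≢ b → Side ⟦ a < c ⟧ ⟦ b < c ⟧ ⟦ c < a ⟧ ⟦ c < b ⟧
side {a} {b} {c} a<b c≢a c≢b with <-cmp c a | <-cmp c b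
... | tri≈ _ c≡a _ | _ = ⊥-elim (c≢a c≡a)
... | _ | tri≈ _ c≡b _ = ⊥-elim (c≢b c≡b)
... | tri< c<a _ _ | _
  rewrite ≥⇒⟦<⟧≡0 (<⇒≤ c<a) | ≥⇒⟦<⟧≡0 (<⇒≤ (<-trans c<a a<b)) | <⇒⟦<⟧≡1 c<a | <⇒⟦<⟧≡1 (<-trans c<a a<b) = below
... | tri> _ _ a<c | tri< c<b _ _
  rewrite <⇒⟦<⟧≡1 a<c | ≥⇒⟦<⟧≡0 (<⇒≤ c<b) | ≥⇒⟦<⟧≡0 (<⇒≤ a<c) | <⇒⟦<⟧≡1 c<b = inside
... | tri> _ _ a<c | tri> _ _ b<c
  rewrite <⇒⟦<⟧≡1 a<c | <⇒⟦<⟧≡1 b<c | ≥⇒⟦<⟧≡0 (<⇒≤ a<c) | ≥⇒⟦<⟧≡0 (<⇒≤ b<c) = above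

-- Exchanging the values x < y at positions a < b does not decrease the
-- number of inversions formed with a third position c holding value z.
side-swap-≤ : ∀ {A₁ B₁ C₁ D₁ A₂ B₂ C₂ D₂} → Side A₁ B₁ C₁ D₁ → Side A₂ B₂ C₂ D₂ →
  A₁ * C₂ + B₁ * D₂ + (C₁ * A₂ + D₁ * B₂) ≤ A₁ * D₂ + B₁ * C₂ + (C₁ * B₂ + D₁ * A₂)
side-swap-≤ below below = ≤ᵇ⇒≤ _ _ tt
side-swap-≤ below inside = ≤ᵇ⇒≤ _ _ tt
side-swap-≤ below above = ≤ᵇ⇒≤ _ _ tt
side-swap-≤ inside below = ≤ᵇ⇒≤ _ _ tt
side-swap-≤ inside inside = ≤ᵇ⇒≤ _ _ tt
side-swap-≤ inside above = ≤ᵇ⇒≤ _ _ tt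
side-swap-≤ above below = ≤ᵇ⇒≤ _ _ tt
side-swap-≤ above inside = ≤ᵇ⇒≤ _ _ tt
side-swap-≤ above above = ≤ᵇ⇒≤ _ _ tt

ℓ-swap-< : ∀ {p q : Fin k} {w w′ : Perm k} → toℕ p < toℕ q → val w p < val w q → SwapAt p q w w′ → ℓ w < ℓ w′
ℓ-swap-< {k} {p} {q} {w} {w′} p<q wp<wq s =
  subst₂ _<_ (sym (ℓ≡inversions w)) (sym (ℓ≡inversions w′)) (∑∑-mono-< q≢p D D′ corner< cross≤ interior≤)
  where
  open SwapAt s
  q≢p : q ≢ p
  q≢p q≡p = <-irrefl (cong toℕ (sym q≡p)) p<q
  toℕ-≢ : ∀ {x y : Fin k} → x ≢ y → toℕ x ≢ toℕ y
  toℕ-≢ x≢y = x≢y ∘ toℕ-injective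
  val-≢ : ∀ {x y : Fin k} → x ≢ y → val w x ≢ val w y
  val-≢ x≢y = x≢y ∘ perm-injective w ∘ toℕ-injective
  D D′ : Fin k → Fin k → ℕ
  D i j = ⟦ toℕ i < toℕ j ⟧ * ⟦ val w j < val w i ⟧
  D′ i j = ⟦ toℕ i < toℕ j ⟧ * ⟦ val w′ j < val w′ i ⟧
  cornerD≡0 : corner p q D ≡ 0
  cornerD≡0 rewrite ⟦<⟧-irrefl (toℕ p) | ⟦<⟧-irrefl (toℕ q) | ≥⇒⟦<⟧≡0 (<⇒≤ wp<wq) | ≥⇒⟦<⟧≡0 (<⇒≤ p<q)
    | *-zeroʳ ⟦ toℕ p < toℕ q ⟧ = refl
  D′pq≡1 : D′ p q ≡ 1
  D′pq≡1 rewrite at-p | at-q | <⇒⟦<⟧≡1 p<q | <⇒⟦<⟧≡1 wp<wq = refl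
  corner< : corner p q D < corner p q D′
  corner< = begin-strict
    corner p q D                    ≡⟨ cornerD≡0 ⟩
    0                              <⟨ s≤s z≤n ⟩
    1                              ≡⟨ D′pq≡1 ⟨
    D′ p q                         ≤⟨ m≤n+m (D′ p q) (D′ p p) ⟩
    D′ p p + D′ p q                ≤⟨ m≤m+n _ (D′ q p + D′ q q) ⟩
    corner p q D′                   ∎
    where open ≤-Reasoning
  -- Stated for x′ y′ z′ equal to the values after the swap, so that matching on refl substitutes them.
  cross-swap : ∀ {x y z x′ y′ z′} → x′ ≡ y → y′ ≡ x → z′ ≡ z → ∀ {a b c} → a < b → c ≢ a → c ≢ b → x < y → z ≢ x → z ≢ y →
    ⟦ a < c ⟧ * ⟦ z < x ⟧ + ⟦ b < c ⟧ * ⟦ z < y ⟧ + (⟦ c < a ⟧ * ⟦ x < z ⟧ + ⟦ c < b ⟧ * ⟦ y < z ⟧)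
      ≤ ⟦ a < c ⟧ * ⟦ z′ < x′ ⟧ + ⟦ b < c ⟧ * ⟦ z′ < y′ ⟧ + (⟦ c < a ⟧ * ⟦ x′ < z′ ⟧ + ⟦ c < b ⟧ * ⟦ y′ < z′ ⟧)
  cross-swap refl refl refl a<b c≢a c≢b x<y z≢x z≢y = side-swap-≤ (side a<b c≢a c≢b) (side x<y z≢x z≢y)
  cross≤ : ∀ x → x ≢ p → x ≢ q → cross p q D x ≤ cross p q D′ x
  cross≤ x x≢p x≢q = cross-swap (cong toℕ at-p) (cong toℕ at-q) (cong toℕ (elsewhere x≢p x≢q))
    p<q (toℕ-≢ x≢p) (toℕ-≢ x≢q) wp<wq (val-≢ x≢p) (val-≢ x≢q)
  interior≤ : ∀ i j → i ≢ p → i ≢ q → j ≢ p → j ≢ q → D i j ≤ D′ i j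
  interior≤ i j i≢p i≢q j≢p j≢q = ≤-reflexive (cong₂ (λ x y → ⟦ toℕ i < toℕ j ⟧ * ⟦ toℕ x < toℕ y ⟧)
    (sym (elsewhere j≢p j≢q)) (sym (elsewhere i≢p i≢q)))

-- The rank criterion for the Bruhat order

rank : Perm k → ℕ → ℕ → ℕ
rank {k} w a b = ∑[ i < k ] (⟦ toℕ i < a ⟧ * ⟦ b < suc (val w i) ⟧)

infix 4 _⊴_

_⊴_ : Perm k → Perm k → Set
u ⊴ v = ∀ a b → rank u a b ≤ rank v a b

⊴-trans : ∀ {u v w : Perm k} → u ⊴ v → v ⊴ w → u ⊴ w
⊴-trans u⊴v v⊴w a b = ≤-trans (u⊴v a b) (v⊴w a b)

rank-cong : ∀ {u v : Perm k} → u ≈ₚ v → ∀ a b → rank u a b ≡ rank v a b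
rank-cong {k} u≈v a b = sum-cong-≗ {k} (λ i → cong (λ x → ⟦ toℕ i < a ⟧ * ⟦ b < suc (toℕ x) ⟧) (u≈v i))

≈⇒⊴ : ∀ {u v : Perm k} → u ≈ₚ v → u ⊴ v
≈⇒⊴ {u = u} {v} u≈v a b = ≤-reflexive (rank-cong {u = u} {v} u≈v a b)

rank-suc : ∀ (w : Perm k) (p : Fin k) b → rank w (suc (toℕ p)) b ≡ rank w (toℕ p) b + ⟦ b < suc (val w p) ⟧
rank-suc {k} w p b = begin
  rank w (suc (toℕ p)) b                 ≡⟨ sum-zeroAt p term₁ ⟩
  term₁ p + sum (zeroAt p term₁)         ≡⟨ cong₂ _+_ term₁p≡X (sum-cong-≗ {k} (zeroAt-cong p term₁≡term₀)) ⟩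
  X + sum (zeroAt p term₀)               ≡⟨ +-comm X _ ⟩
  sum (zeroAt p term₀) + X               ≡⟨ cong (λ t → t + sum (zeroAt p term₀) + X) term₀p≡0 ⟨
  term₀ p + sum (zeroAt p term₀) + X     ≡⟨ cong (_+ X) (sum-zeroAt p term₀) ⟨
  rank w (toℕ p) b + X                   ∎
  where
  open ≡-Reasoning
  X = ⟦ b < suc (val w p) ⟧
  term₁ term₀ : Fin k → ℕ
  term₁ i = ⟦ toℕ i < suc (toℕ p) ⟧ * ⟦ b < suc (val w i) ⟧
  term₀ i = ⟦ toℕ i < toℕ p ⟧ * ⟦ b < suc (val w i) ⟧
  term₁p≡X : term₁ p ≡ X
  term₁p≡X rewrite <⇒⟦<⟧≡1 (n<1+n (toℕ p)) = *-identityˡ X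
  term₀p≡0 : term₀ p ≡ 0
  term₀p≡0 rewrite ⟦<⟧-irrefl (toℕ p) = refl
  term₁≡term₀ : ∀ i → i ≢ p → term₁ i ≡ term₀ i
  term₁≡term₀ i i≢p = cong (_* ⟦ b < suc (val w i) ⟧) (⟦<suc⟧-≢ (i≢p ∘ toℕ-injective))

rank-prefix : ∀ {u v : Perm k} a → (∀ i → toℕ i < a → u ⟨$⟩ʳ i ≡ v ⟨$⟩ʳ i) → ∀ b → rank u a b ≡ rank v a b
rank-prefix {k} {u} {v} a agree b = sum-cong-≗ {k} term
  where
  term : ∀ i → ⟦ toℕ i < a ⟧ * ⟦ b < suc (val u i) ⟧ ≡ ⟦ toℕ i < a ⟧ * ⟦ b < suc (val v i) ⟧
  term i with toℕ i <? a
  ... | yes i<a = cong (λ x → ⟦ toℕ i < a ⟧ * ⟦ b < suc (toℕ x) ⟧) (agree i i<a)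
  ... | no i≮a rewrite ≥⇒⟦<⟧≡0 (≮⇒≥ i≮a) = refl

rank-beyond : ∀ {k} (w : Perm k) a b → k ≤ a → rank w (suc a) b ≡ rank w a b
rank-beyond {k} w a b k≤a = sum-cong-≗ {k} (λ i → cong (_* ⟦ b < suc (val w i) ⟧)
  (trans (<⇒⟦<⟧≡1 (≤-trans (toℕ<n i) (m≤n⇒m≤1+n k≤a))) (sym (<⇒⟦<⟧≡1 (≤-trans (toℕ<n i) k≤a)))))

swap-bits : ∀ {P Q X Y} → Q ⊑ P → X ⊑ Y →
  P * Y + Q * X ≡ P * X + Q * Y + (P ∸ Q) * (Y ∸ X)
swap-bits 0⊑0 0⊑0 = refl
swap-bits 0⊑0 0⊑1 = refl
swap-bits 0⊑0 1⊑1 = refl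
swap-bits 0⊑1 0⊑0 = refl
swap-bits 0⊑1 0⊑1 = refl
swap-bits 0⊑1 1⊑1 = refl
swap-bits 1⊑1 0⊑0 = refl
swap-bits 1⊑1 0⊑1 = refl
swap-bits 1⊑1 1⊑1 = refl

swap-gain : ∀ {P Q X Y} → Q ⊑ P → X ⊑ Y →
  (P ∸ Q) * (Y ∸ X) ≡ 0 ⊎ ((P ∸ Q) * (Y ∸ X) ≡ 1 × P ≡ 1 × Q ≡ 0 × X ≡ 0 × Y ≡ 1)
swap-gain 0⊑1 0⊑1 = inj₂ (refl , refl , refl , refl , refl)
swap-gain 0⊑0 _ = inj₁ refl
swap-gain 1⊑1 _ = inj₁ refl
swap-gain 0⊑1 0⊑0 = inj₁ refl
swap-gain 0⊑1 1⊑1 = inj₁ refl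

module RankSwap {p q : Fin k} {w w′ : Perm k} (p<q : toℕ p < toℕ q) (wp<wq : val w p < val w q)
                (s : SwapAt p q w w′) (a b : ℕ) where
  open SwapAt s

  P Q X Y : ℕ
  P = ⟦ toℕ p < a ⟧
  Q = ⟦ toℕ q < a ⟧
  X = ⟦ b < suc (val w p) ⟧
  Y = ⟦ b < suc (val w q) ⟧

  gain : ℕ
  gain = (P ∸ Q) * (Y ∸ X)

  private
    term : Perm k → Fin k → ℕ
    term z i = ⟦ toℕ i < a ⟧ * ⟦ b < suc (val z i) ⟧
    q≢p : q ≢ p
    q≢p q≡p = <-irrefl (cong toℕ (sym q≡p)) p<q
    rest : ℕ
    rest = sum (zeroAt₂ p q (term w))
    rank-w : rank w a b ≡ P * X + Q * Y + rest
    rank-w = sum-zeroAt₂ q≢p (term w)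
    rank-w′ : rank w′ a b ≡ P * Y + Q * X + rest
    rank-w′ = trans (sum-zeroAt₂ q≢p (term w′))
      (cong₂ _+_ (cong₂ (λ x y → P * ⟦ b < suc (toℕ x) ⟧ + Q * ⟦ b < suc (toℕ y) ⟧) at-p at-q)
                 (sum-cong-≗ {k} (zeroAt₂-cong p q (λ j j≢p j≢q → cong (λ x → ⟦ toℕ j < a ⟧ * ⟦ b < suc (toℕ x) ⟧) (elsewhere j≢p j≢q)))))

  Q⊑P : Q ⊑ P
  Q⊑P = ⟦<⟧-antiˡ {a} (<⇒≤ p<q)

  X⊑Y : X ⊑ Y
  X⊑Y = ⟦<⟧-monoʳ {b} (s≤s (<⇒≤ wp<wq))

  rank-swap : rank w′ a b ≡ rank w a b + gain
  rank-swap = begin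
    rank w′ a b                        ≡⟨ rank-w′ ⟩
    P * Y + Q * X + rest               ≡⟨ cong (_+ rest) (swap-bits Q⊑P X⊑Y) ⟩
    P * X + Q * Y + gain + rest        ≡⟨ +-assoc (P * X + Q * Y) gain rest ⟩
    P * X + Q * Y + (gain + rest)      ≡⟨ cong (P * X + Q * Y +_) (+-comm gain rest) ⟩
    P * X + Q * Y + (rest + gain)      ≡⟨ +-assoc (P * X + Q * Y) rest gain ⟨
    P * X + Q * Y + rest + gain        ≡⟨ cong (_+ gain) rank-w ⟨
    rank w a b + gain                  ∎
    where open ≡-Reasoning

module _ {p q : Fin k} {w w′ : Perm k} (p<q : toℕ p < toℕ q) (wp<wq : val w p < val w q) (s : SwapAt p q w w′) where

  ⊴-swap : w ⊴ w′
  ⊴-swap a b = subst (rank w a b ≤_) (sym rank-swap) (m≤m+n (rank w a b) gain)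
    where open RankSwap p<q wp<wq s a b

  rank-swap-< : rank w (suc (toℕ p)) (val w q) < rank w′ (suc (toℕ p)) (val w q)
  rank-swap-< = subst (rank w a b <_) (sym rank-swap) (m<m+n (rank w a b) (subst (0 <_) (sym gain≡1) (s≤s z≤n)))
    where
    a = suc (toℕ p)
    b = val w q
    open RankSwap p<q wp<wq s a b
    gain≡1 : gain ≡ 1
    gain≡1 rewrite <⇒⟦<⟧≡1 (n<1+n (toℕ p)) | ≥⇒⟦<⟧≡0 p<q | ≥⇒⟦<⟧≡0 wp<wq | <⇒⟦<⟧≡1 (n<1+n (val w q)) = refl

ℓ-SwapAt-<⇒⊴ : ∀ {p q : Fin k} {u v : Perm k} → toℕ p < toℕ q → SwapAt p q u v → ℓ u < ℓ v → u ⊴ v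
ℓ-SwapAt-<⇒⊴ {p = p} {q} {u} {v} p<q s ℓu<ℓv with <-cmp (val u p) (val u q)
... | tri< up<uq _ _ = ⊴-swap p<q up<uq s
... | tri≈ _ up≡uq _ = ⊥-elim (<-irrefl (cong toℕ (perm-injective u (toℕ-injective up≡uq))) p<q)
... | tri> _ _ uq<up = ⊥-elim (<-asym ℓu<ℓv (ℓ-swap-< p<q vp<vq (SwapAt-sym s)))
  where
  open SwapAt s
  vp<vq : val v p < val v q
  vp<vq = subst₂ _<_ (sym (cong toℕ at-p)) (sym (cong toℕ at-q)) uq<up

BruhatStep⇒⊴ : ∀ {u v : Perm k} → BruhatStep u v → u ⊴ v
BruhatStep⇒⊴ {u = u} {v} (i , j , v≡u∘t , ℓu<ℓv) with <-cmp (toℕ i) (toℕ j)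
... | tri< i<j _ _ = ℓ-SwapAt-<⇒⊴ i<j (transpose-SwapAt {u = u} {v} v≡u∘t) ℓu<ℓv
... | tri> _ _ j<i = ℓ-SwapAt-<⇒⊴ j<i (SwapAt-comm (transpose-SwapAt {u = u} {v} v≡u∘t)) ℓu<ℓv
... | tri≈ _ i≡j _ = ⊥-elim (<-irrefl (sym (ℓ-cong {u = v} {u} (SwapAt-refl⇒≈ s))) ℓu<ℓv)
  where
  s : SwapAt i i u v
  s = subst (λ j → SwapAt i j u v) (sym (toℕ-injective i≡j)) (transpose-SwapAt v≡u∘t)

TransClosure⇒⊴ : ∀ {u v : Perm k} → TransClosure BruhatStep u v → u ⊴ v
TransClosure⇒⊴ {u = u} {v} [ step ] = BruhatStep⇒⊴ {u = u} {v} step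
TransClosure⇒⊴ {u = u} {v} (_∷_ {y = y} step chain) =
  ⊴-trans {u = u} {y} {v} (BruhatStep⇒⊴ {u = u} {y} step) (TransClosure⇒⊴ {u = y} {v} chain)

≤B⇒⊴ : ∀ {u v : Perm k} → u ≤B v → u ⊴ v
≤B⇒⊴ {u = u} {v} (inj₁ u≈v) = ≈⇒⊴ {u = u} {v} u≈v
≤B⇒⊴ (inj₂ chain) = TransClosure⇒⊴ chain

Exchangeable : Perm k → Perm k → Fin k → Fin k → Set
Exchangeable u v p i = toℕ p < toℕ i × val u p < val u i × val u i ≤ val v p

rank-<-window : ∀ {u v : Perm k} {p q : Fin k} → u ⊴ v →
  (∀ i → toℕ i < toℕ p → u ⟨$⟩ʳ i ≡ v ⟨$⟩ʳ i) →
  (∀ i → toℕ i < toℕ q → ¬ Exchangeable u v p i) →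
  ∀ {a b} → toℕ p < a → a ≤ toℕ q → val u p < b → b ≤ val v p → rank u a b < rank v a b
rank-<-window {k} {u} {v} {p} {q} u⊴v agree minimal {a} {b} p<a a≤q up<b b≤vp = begin-strict
  rank u a b                 ≡⟨ split u ⟩
  rank u a c + sum (G u)     <⟨ +-mono-≤-< (u⊴v a c) (sum-mono-< p G≤ Gup<Gvp) ⟩
  rank v a c + sum (G v)     ≡⟨ split v ⟨
  rank v a b                 ∎
  where
  open ≤-Reasoning
  c = suc (val v p)
  G : Perm k → Fin k → ℕ
  G w i = ⟦ toℕ i < a ⟧ * (⟦ b < suc (val w i) ⟧ * ⟦ val w i < c ⟧)
  split : ∀ w → rank w a b ≡ rank w a c + sum (G w)
  split w = trans (sum-cong-≗ {k} (λ i → trans (cong (⟦ toℕ i < a ⟧ *_) (⟦≤⟧-split (val w i) (≤-trans b≤vp (n≤1+n _))))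
                                               (*-distribˡ-+ ⟦ toℕ i < a ⟧ _ _)))
                  (∑-distrib-+ {k} _ (G w))
  Gup≡0 : G u p ≡ 0
  Gup≡0 rewrite ≥⇒⟦<⟧≡0 {b} {suc (val u p)} up<b = *-zeroʳ ⟦ toℕ p < a ⟧
  Gvp≡1 : G v p ≡ 1
  Gvp≡1 rewrite <⇒⟦<⟧≡1 p<a | <⇒⟦<⟧≡1 {b} {suc (val v p)} (s≤s b≤vp) | <⇒⟦<⟧≡1 (n<1+n (val v p)) = refl
  Gui≡0 : ∀ i → toℕ p < toℕ i → G u i ≡ 0
  Gui≡0 i p<i with toℕ i <? a
  ... | no i≮a rewrite ≥⇒⟦<⟧≡0 (≮⇒≥ i≮a) = refl
  ... | yes i<a with b ≤? val u i
  ...   | no b≰ui rewrite ≥⇒⟦<⟧≡0 {b} {suc (val u i)} (≰⇒> b≰ui) = *-zeroʳ ⟦ toℕ i < a ⟧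
  ...   | yes b≤ui with val u i <? c
  ...     | no ui≮c rewrite ≥⇒⟦<⟧≡0 (≮⇒≥ ui≮c) = trans (cong (⟦ toℕ i < a ⟧ *_) (*-zeroʳ ⟦ b < suc (val u i) ⟧)) (*-zeroʳ ⟦ toℕ i < a ⟧)
  ...     | yes ui<c = ⊥-elim (minimal i (<-≤-trans i<a a≤q) (p<i , <-≤-trans up<b b≤ui , ≤-pred ui<c))
  G≤ : ∀ i → G u i ≤ G v i
  G≤ i with <-cmp (toℕ i) (toℕ p)
  ... | tri< i<p _ _ = ≤-reflexive (cong (λ x → ⟦ toℕ i < a ⟧ * (⟦ b < suc (toℕ x) ⟧ * ⟦ toℕ x < c ⟧)) (agree i i<p))
  ... | tri≈ _ i≡p _ = subst (λ j → G u j ≤ G v j) (sym (toℕ-injective i≡p)) (≤-trans (≤-reflexive Gup≡0) z≤n)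
  ... | tri> _ _ p<i = ≤-trans (≤-reflexive (Gui≡0 i p<i)) z≤n
  Gup<Gvp : G u p < G v p
  Gup<Gvp = subst₂ _<_ (sym Gup≡0) (sym Gvp≡1) (s≤s z≤n)

private
  below-Fin′ : ∀ {p : Fin k} {P : Fin k → Set} → (∀ (j : Fin′ p) → P (inject j)) → ∀ i → toℕ i < toℕ p → P i
  below-Fin′ {P = P} all-below i i<p =
    subst P (toℕ-injective (trans (toℕ-inject (fromℕ< i<p)) (toℕ-fromℕ< i<p))) (all-below (fromℕ< i<p))

first-difference : ∀ (u v : Perm k) → u ≈ₚ v ⊎
  Σ[ p ∈ Fin k ] (u ⟨$⟩ʳ p ≢ v ⟨$⟩ʳ p × (∀ i → toℕ i < toℕ p → u ⟨$⟩ʳ i ≡ v ⟨$⟩ʳ i))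
first-difference {k} u v with all? (λ i → u ⟨$⟩ʳ i ≟ᶠ v ⟨$⟩ʳ i)
... | yes u≈v = inj₁ u≈v
... | no u≉v with ¬∀⟶∃¬-smallest k _ (λ i → u ⟨$⟩ʳ i ≟ᶠ v ⟨$⟩ʳ i) u≉v
...   | p , up≢vp , agree = inj₂ (p , up≢vp , below-Fin′ agree)

least : ∀ {Q : Fin k → Set} → Decidable Q → ∀ {j} → Q j → Σ[ q ∈ Fin k ] (Q q × (∀ i → toℕ i < toℕ q → ¬ Q i))
least {k} {Q} Q? {j} Qj with ¬∀⟶∃¬-smallest k (¬_ ∘ Q) (¬? ∘ Q?) (λ ∀¬Q → ∀¬Q j Qj)
... | q , ¬¬Qq , before = q , decidable-stable (Q? q) ¬¬Qq , below-Fin′ before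

⊴-first-difference : ∀ {u v : Perm k} {p : Fin k} → u ⊴ v → u ⟨$⟩ʳ p ≢ v ⟨$⟩ʳ p →
  (∀ i → toℕ i < toℕ p → u ⟨$⟩ʳ i ≡ v ⟨$⟩ʳ i) → val u p < val v p
⊴-first-difference {u = u} {v} {p} u⊴v up≢vp agree = ≤∧≢⇒< up≤vp (up≢vp ∘ toℕ-injective)
  where
  c = suc (val v p)
  up≤vp : val u p ≤ val v p
  up≤vp = ≤-pred (⟦<⟧≡0⇒≥ (n≤0⇒n≡0 (+-cancelˡ-≤ (rank v (toℕ p) c) _ _ (begin
    rank v (toℕ p) c + ⟦ c < suc (val u p) ⟧   ≡⟨ cong (_+ ⟦ c < suc (val u p) ⟧) (rank-prefix {u = u} {v} (toℕ p) agree c) ⟨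
    rank u (toℕ p) c + ⟦ c < suc (val u p) ⟧   ≡⟨ rank-suc u p c ⟨
    rank u (suc (toℕ p)) c                     ≤⟨ u⊴v (suc (toℕ p)) c ⟩
    rank v (suc (toℕ p)) c                     ≡⟨ rank-suc v p c ⟩
    rank v (toℕ p) c + ⟦ c < c ⟧               ≡⟨ cong (rank v (toℕ p) c +_) (⟦<⟧-irrefl c) ⟩
    rank v (toℕ p) c + 0                       ∎))))
    where open ≤-Reasoning

first-exchangeable : ∀ {u v : Perm k} {p : Fin k} → val u p < val v p → (∀ i → toℕ i < toℕ p → u ⟨$⟩ʳ i ≡ v ⟨$⟩ʳ i) →
  Σ[ q ∈ Fin k ] (Exchangeable u v p q × (∀ i → toℕ i < toℕ q → ¬ Exchangeable u v p i))
first-exchangeable {k} {u} {v} {p} up<vp agree =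
  least exchangeable? {j} (p<j , subst (val u p <_) (sym (cong toℕ uj≡vp)) up<vp , ≤-reflexive (cong toℕ uj≡vp))
  where
  exchangeable? : ∀ i → Dec (Exchangeable u v p i)
  exchangeable? i = (toℕ p <? toℕ i) ×-dec (val u p <? val u i) ×-dec (val u i ≤? val v p)
  j : Fin k
  j = u ⟨$⟩ˡ (v ⟨$⟩ʳ p)
  uj≡vp : u ⟨$⟩ʳ j ≡ v ⟨$⟩ʳ p
  uj≡vp = inverseʳ u
  p<j : toℕ p < toℕ j
  p<j with <-cmp (toℕ p) (toℕ j)
  ... | tri< p<j _ _ = p<j
  ... | tri≈ _ p≡j _ = ⊥-elim (<-irrefl (cong toℕ (trans (cong (u ⟨$⟩ʳ_) (toℕ-injective p≡j)) uj≡vp)) up<vp)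
  ... | tri> _ _ j<p = ⊥-elim (<-irrefl (cong toℕ (perm-injective v (trans (sym (agree j j<p)) uj≡vp))) j<p)

swap-exchangeable-⊴ : ∀ {u v : Perm k} {p q : Fin k} → u ⊴ v → (∀ i → toℕ i < toℕ p → u ⟨$⟩ʳ i ≡ v ⟨$⟩ʳ i) →
  Exchangeable u v p q → (∀ i → toℕ i < toℕ q → ¬ Exchangeable u v p i) → transpose p q ∘ₚ u ⊴ v
swap-exchangeable-⊴ {u = u} {v} {p} {q} u⊴v agree (p<q , up<uq , uq≤vp) minimal a b = bound (swap-gain Q⊑P X⊑Y)
  where
  open RankSwap p<q up<uq (transpose-SwapAt {u = u} {transpose p q ∘ₚ u} (λ _ → refl)) a b
  open ≤-Reasoning
  bound : gain ≡ 0 ⊎ (gain ≡ 1 × P ≡ 1 × Q ≡ 0 × X ≡ 0 × Y ≡ 1) → rank (transpose p q ∘ₚ u) a b ≤ rank v a b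
  bound (inj₁ gain≡0) = begin
    rank (transpose p q ∘ₚ u) a b   ≡⟨ rank-swap ⟩
    rank u a b + gain               ≡⟨ cong (rank u a b +_) gain≡0 ⟩
    rank u a b + 0                  ≡⟨ +-identityʳ (rank u a b) ⟩
    rank u a b                      ≤⟨ u⊴v a b ⟩
    rank v a b                      ∎
  bound (inj₂ (gain≡1 , P≡1 , Q≡0 , X≡0 , Y≡1)) = begin
    rank (transpose p q ∘ₚ u) a b   ≡⟨ rank-swap ⟩
    rank u a b + gain               ≡⟨ trans (cong (rank u a b +_) gain≡1) (+-comm (rank u a b) 1) ⟩
    suc (rank u a b)                ≤⟨ rank-<-window {u = u} {v} {p} {q} u⊴v agree minimal {a} {b}
                                         (⟦<⟧≡1⇒< P≡1) (⟦<⟧≡0⇒≥ Q≡0) (⟦<⟧≡0⇒≥ X≡0) (≤-trans (≤-pred (⟦<⟧≡1⇒< Y≡1)) uq≤vp) ⟩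
    rank v a b                      ∎

swap-toward : ∀ {u v : Perm k} → u ⊴ v → (p : Fin k) → u ⟨$⟩ʳ p ≢ v ⟨$⟩ʳ p →
  (∀ i → toℕ i < toℕ p → u ⟨$⟩ʳ i ≡ v ⟨$⟩ʳ i) →
  Σ[ q ∈ Fin k ] (toℕ p < toℕ q × val u p < val u q × transpose p q ∘ₚ u ⊴ v)
swap-toward {u = u} {v} u⊴v p up≢vp agree
  with first-exchangeable {u = u} {v} {p} (⊴-first-difference {u = u} {v} u⊴v up≢vp agree) agree
... | q , exchangeable@(p<q , up<uq , _) , minimal =
  q , p<q , up<uq , swap-exchangeable-⊴ {u = u} {v} u⊴v agree exchangeable minimal

rank-total : Perm k → ℕ
rank-total {k} w = ∑[ a < suc k ] ∑[ b < suc k ] rank w (toℕ a) (toℕ b)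

rank-total-mono : ∀ {u v : Perm k} → u ⊴ v → rank-total u ≤ rank-total v
rank-total-mono {k} u⊴v = sum-mono-≤ {suc k} (λ a → sum-mono-≤ {suc k} (λ b → u⊴v (toℕ a) (toℕ b)))

rank-total-swap-< : ∀ {p q : Fin k} {w w′ : Perm k} → toℕ p < toℕ q → val w p < val w q → SwapAt p q w w′ →
  rank-total w < rank-total w′
rank-total-swap-< {k} {p} {q} {w} {w′} p<q wp<wq s =
  sum-mono-< {suc k} (suc p) (λ a → sum-mono-≤ {suc k} (λ b → w⊴w′ (toℕ a) (toℕ b)))
    (sum-mono-< {suc k} (inject₁ (w ⟨$⟩ʳ q)) (λ b → w⊴w′ (suc (toℕ p)) (toℕ b))
      (subst (λ b → rank w (suc (toℕ p)) b < rank w′ (suc (toℕ p)) b) (sym (toℕ-inject₁ (w ⟨$⟩ʳ q)))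
        (rank-swap-< p<q wp<wq s)))
  where
  w⊴w′ : w ⊴ w′
  w⊴w′ = ⊴-swap p<q wp<wq s

BruhatStep-respʳ-≈ : ∀ {u v v′ : Perm k} → v ≈ₚ v′ → BruhatStep u v → BruhatStep u v′
BruhatStep-respʳ-≈ {u = u} {v} {v′} v≈v′ (i , j , v≡u∘t , ℓu<ℓv) =
  i , j , (λ x → trans (sym (v≈v′ x)) (v≡u∘t x)) , subst (ℓ u <_) (ℓ-cong {u = v} {v′} v≈v′) ℓu<ℓv

BruhatStep-≤B : ∀ {u v w : Perm k} → BruhatStep u v → v ≤B w → u ≤B w
BruhatStep-≤B {u = u} {v} {w} step (inj₁ v≈w) = inj₂ [ BruhatStep-respʳ-≈ {u = u} {v} {w} v≈w step ]
BruhatStep-≤B step (inj₂ chain) = inj₂ (step ∷ chain)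

-- Greedy ascent: the total rank grows with each swap and is bounded by that of v.
⊴⇒≤B : ∀ {u v : Perm k} → u ⊴ v → u ≤B v
⊴⇒≤B {k} {u} {v} u⊴v = ascend (rank-total v) u⊴v (m≤n+m (rank-total v) (rank-total u))
  where
  ascend : ∀ n {u} → u ⊴ v → rank-total v ≤ rank-total u + n → u ≤B v
  ascend n {u} u⊴v bound with first-difference u v
  ... | inj₁ u≈v = inj₁ u≈v
  ... | inj₂ (p , up≢vp , agree) with swap-toward {u = u} {v} u⊴v p up≢vp agree
  ...   | q , p<q , up<uq , u′⊴v = BruhatStep-≤B {u = u} {u′} {v} (p , q , (λ _ → refl) , ℓ-swap-< p<q up<uq s) (continue n bound)
    where
    u′ = transpose p q ∘ₚ u
    s : SwapAt p q u u′
    s = transpose-SwapAt {u = u} {u′} (λ _ → refl)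
    grows : rank-total u < rank-total u′
    grows = rank-total-swap-< {w = u} {u′} p<q up<uq s
    continue : ∀ n → rank-total v ≤ rank-total u + n → u′ ≤B v
    continue zero bound = ⊥-elim (<-irrefl refl (≤-trans grows (≤-trans (rank-total-mono {u = u′} {v} u′⊴v) (≤-trans bound (≤-reflexive (+-identityʳ (rank-total u)))))))
    continue (suc n) bound = ascend n {u′} u′⊴v (≤-trans bound (≤-trans (≤-reflexive (+-suc (rank-total u) n)) (+-monoˡ-≤ n grows)))

dbl : ℕ → ℕ
dbl zero = zero
dbl (suc n) = suc (suc (dbl n))

*2≡dbl : ∀ n → n * 2 ≡ dbl n
*2≡dbl zero = refl
*2≡dbl (suc n) = cong (λ x → suc (suc x)) (*2≡dbl n)

halve : ∀ n → Σ[ h ∈ ℕ ] Σ[ r ∈ Fin 2 ] n ≡ dbl h + toℕ r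
halve zero = 0 , zero , refl
halve (suc zero) = 0 , suc zero , refl
halve (suc (suc n)) with halve n
... | h , r , n≡ = suc h , r , cong (λ x → suc (suc x)) n≡

evenℕ-dbl : ∀ n → evenℕ (dbl n) ≡ true
evenℕ-dbl zero = refl
evenℕ-dbl (suc n) = evenℕ-dbl n

evenℕ-suc-dbl : ∀ n → evenℕ (suc (dbl n)) ≡ false
evenℕ-suc-dbl zero = refl
evenℕ-suc-dbl (suc n) = evenℕ-suc-dbl n

⟦dbl+<dbl+⟧-≢ : ∀ {a b} (r s : Fin 2) → a ≢ b → ⟦ dbl a + toℕ r < dbl b + toℕ s ⟧ ≡ ⟦ a < b ⟧
⟦dbl+<dbl+⟧-≢ {zero} {zero} _ _ 0≢0 = ⊥-elim (0≢0 refl)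
⟦dbl+<dbl+⟧-≢ {zero} {suc b} zero s _ = refl
⟦dbl+<dbl+⟧-≢ {zero} {suc b} (suc zero) s _ = refl
⟦dbl+<dbl+⟧-≢ {suc a} {zero} r zero _ = refl
⟦dbl+<dbl+⟧-≢ {suc a} {zero} r (suc zero) _ = refl
⟦dbl+<dbl+⟧-≢ {suc a} {suc b} r s a≢b = ⟦dbl+<dbl+⟧-≢ r s (λ a≡b → a≢b (cong suc a≡b))

⟦dbl+<dbl+⟧-≡ : ∀ a r s → ⟦ dbl a + r < dbl a + s ⟧ ≡ ⟦ r < s ⟧
⟦dbl+<dbl+⟧-≡ zero r s = refl
⟦dbl+<dbl+⟧-≡ (suc a) r s = ⟦dbl+<dbl+⟧-≡ a r s

⟦dbl+<dbl⟧ : ∀ a b (r : Fin 2) → ⟦ dbl a + toℕ r < dbl b ⟧ ≡ ⟦ a < b ⟧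
⟦dbl+<dbl⟧ a zero r = refl
⟦dbl+<dbl⟧ zero (suc b) zero = refl
⟦dbl+<dbl⟧ zero (suc b) (suc zero) = refl
⟦dbl+<dbl⟧ (suc a) (suc b) r = ⟦dbl+<dbl⟧ a b r

⟦dbl+≤dbl+⟧ : ∀ β x (σ t : Fin 2) → ⟦ dbl β + toℕ σ < suc (dbl x + toℕ t) ⟧ ≡ ⟦ β + ⟦ toℕ t < toℕ σ ⟧ < suc x ⟧
⟦dbl+≤dbl+⟧ zero x zero t = refl
⟦dbl+≤dbl+⟧ zero zero (suc zero) zero = refl
⟦dbl+≤dbl+⟧ zero zero (suc zero) (suc zero) = refl
⟦dbl+≤dbl+⟧ zero (suc x) (suc zero) zero = refl
⟦dbl+≤dbl+⟧ zero (suc x) (suc zero) (suc zero) = refl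
⟦dbl+≤dbl+⟧ (suc β) zero σ zero = refl
⟦dbl+≤dbl+⟧ (suc β) zero σ (suc zero) = refl
⟦dbl+≤dbl+⟧ (suc β) (suc x) σ t = ⟦dbl+≤dbl+⟧ β x σ t

toℕ-combine₂ : ∀ (i : Fin m) (s : Fin 2) → toℕ (combine i s) ≡ dbl (toℕ i) + toℕ s
toℕ-combine₂ {suc m} zero s = toℕ-↑ˡ s (m * 2)
toℕ-combine₂ {suc m} (suc i) s = trans (toℕ-↑ʳ 2 (combine i s)) (cong (λ n → suc (suc n)) (toℕ-combine₂ i s))

toℕ-combine-0 : ∀ (i : Fin m) → toℕ (combine i zero) ≡ dbl (toℕ i)
toℕ-combine-0 i = trans (toℕ-combine₂ i zero) (+-identityʳ (dbl (toℕ i)))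

toℕ-combine-1 : ∀ (i : Fin m) → toℕ (combine i (suc zero)) ≡ suc (dbl (toℕ i))
toℕ-combine-1 i = trans (toℕ-combine₂ i (suc zero)) (+-comm (dbl (toℕ i)) 1)

sum-combine : ∀ (f : Fin (m * 2) → ℕ) → sum f ≡ ∑[ i < m ] (f (combine i zero) + f (combine i (suc zero)))
sum-combine {zero} f = refl
sum-combine {suc m} f = trans (sym (+-assoc (f zero) (f (suc zero)) _)) (cong (f zero + f (suc zero) +_) (sum-combine {m} (λ i → f (suc (suc i)))))

-- The map ψ and W(S_{2m})

ψ-combine : ∀ (u : Perm m) (T : Subset m) i r → ψ u T ⟨$⟩ʳ combine i r ≡ combine (u ⟨$⟩ʳ i) (tw T i r)
ψ-combine {m} u T i r = cong (λ (j , s) → combine (u ⟨$⟩ʳ j) (tw T j s)) (remQuot-combine {m} {2} i r)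

ψ⁻¹-combine : ∀ (u : Perm m) (T : Subset m) j s → ψ u T ⟨$⟩ˡ combine j s ≡ combine (u ⟨$⟩ˡ j) (tw T (u ⟨$⟩ˡ j) s)
ψ⁻¹-combine {m} u T j s = cong (λ (j , s) → combine (u ⟨$⟩ˡ j) (tw T (u ⟨$⟩ˡ j) s)) (remQuot-combine {m} {2} j s)

val-ψ : ∀ (u : Perm m) (T : Subset m) i r → val (ψ u T) (combine i r) ≡ dbl (val u i) + toℕ (tw T i r)
val-ψ u T i r = trans (cong toℕ (ψ-combine u T i r)) (toℕ-combine₂ (u ⟨$⟩ʳ i) (tw T i r))

Subset-ext : ∀ (T T′ : Subset m) → (∀ i → lookup T i ≡ lookup T′ i) → T ≡ T′
Subset-ext T T′ T≗T′ = trans (sym (tabulate∘lookup T)) (trans (tabulate-cong T≗T′) (tabulate∘lookup T′))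

ψ-injective : ∀ (u u′ : Perm m) (T T′ : Subset m) → ψ u T ≈ₚ ψ u′ T′ → (u ≈ₚ u′) × (T ≡ T′)
ψ-injective u u′ T T′ ψ≈ψ′ = (λ i → proj₁ (same-block i)) , Subset-ext T T′ (λ i → tw-zero-injective (proj₂ (same-block i)))
  where
  same-block : ∀ i → u ⟨$⟩ʳ i ≡ u′ ⟨$⟩ʳ i × tw T i zero ≡ tw T′ i zero
  same-block i = combine-injective (u ⟨$⟩ʳ i) (tw T i zero) (u′ ⟨$⟩ʳ i) (tw T′ i zero)
    (trans (sym (ψ-combine u T i zero)) (trans (ψ≈ψ′ (combine i zero)) (ψ-combine u′ T′ i zero)))
  tw-zero-injective : ∀ {i} → tw T i zero ≡ tw T′ i zero → lookup T i ≡ lookup T′ i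
  tw-zero-injective {i} with lookup T i | lookup T′ i
  ... | true | true = λ _ → refl
  ... | false | false = λ _ → refl
  ... | true | false = λ ()
  ... | false | true = λ ()

star-suc-dbl : ∀ n j → suc (suc (dbl j)) ≤ n → star n (suc (dbl j)) ≡ suc (suc (dbl j))
star-suc-dbl n j le rewrite evenℕ-suc-dbl j | dec-true (suc (suc (dbl j)) ≤? n) le = refl

star-dbl : ∀ n j → star n (suc (suc (dbl j))) ≡ suc (dbl j)
star-dbl n j rewrite evenℕ-dbl j = refl

-- In the one-line encoding the paper's values 2j-1 and 2j are combine j 0 and combine j 1,
-- so i ↦ i* exchanges the two values of a block.
star-combine : ∀ (j : Fin m) (s : Fin 2) (b : Fin (m * 2)) → suc (toℕ (combine j s)) < m * 2 →
  suc (toℕ b) ≡ star (m * 2) (suc (toℕ (combine j s))) → b ≡ combine j (swap₂ s)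
star-combine {m} j zero b lt b≡star = toℕ-injective (suc-injective (begin
  suc (toℕ b)                                     ≡⟨ b≡star ⟩
  star (m * 2) (suc (toℕ (combine j zero)))       ≡⟨ cong (star (m * 2) ∘ suc) (toℕ-combine-0 j) ⟩
  star (m * 2) (suc (dbl (toℕ j)))                ≡⟨ star-suc-dbl (m * 2) (toℕ j) (subst (λ x → suc (suc x) ≤ m * 2) (toℕ-combine-0 j) lt) ⟩
  suc (suc (dbl (toℕ j)))                         ≡⟨ cong suc (toℕ-combine-1 j) ⟨
  suc (toℕ (combine j (suc zero)))                ∎))
  where open ≡-Reasoning
star-combine {m} j (suc zero) b lt b≡star = toℕ-injective (suc-injective (begin
  suc (toℕ b)                                     ≡⟨ b≡star ⟩
  star (m * 2) (suc (toℕ (combine j (suc zero)))) ≡⟨ cong (star (m * 2) ∘ suc) (toℕ-combine-1 j) ⟩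
  star (m * 2) (suc (suc (dbl (toℕ j))))          ≡⟨ star-dbl (m * 2) (toℕ j) ⟩
  suc (dbl (toℕ j))                               ≡⟨ cong suc (toℕ-combine-0 j) ⟨
  suc (toℕ (combine j zero))                      ∎))
  where open ≡-Reasoning

∣Fin2-Fin2∣≤1 : ∀ (r s : Fin 2) → ∣ toℕ r - toℕ s ∣ ≤ 1
∣Fin2-Fin2∣≤1 zero zero = z≤n
∣Fin2-Fin2∣≤1 zero (suc zero) = s≤s z≤n
∣Fin2-Fin2∣≤1 (suc zero) zero = s≤s z≤n
∣Fin2-Fin2∣≤1 (suc zero) (suc zero) = z≤n

ψ-InW : ∀ (u : Perm m) (T : Subset m) → InW (ψ u T)
ψ-InW {m} u T a b lt b≡star with combine-surjective {m} {2} a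
... | j , s , refl with star-combine j s b lt b≡star
... | refl rewrite ψ⁻¹-combine u T j s | ψ⁻¹-combine u T j (swap₂ s)
                 | toℕ-combine₂ (u ⟨$⟩ˡ j) (tw T (u ⟨$⟩ˡ j) s) | toℕ-combine₂ (u ⟨$⟩ˡ j) (tw T (u ⟨$⟩ˡ j) (swap₂ s))
                 | ∣m+n-m+o∣≡∣n-o∣ (dbl (toℕ (u ⟨$⟩ˡ j))) (toℕ (tw T (u ⟨$⟩ˡ j) s)) (toℕ (tw T (u ⟨$⟩ˡ j) (swap₂ s)))
  = ∣Fin2-Fin2∣≤1 (tw T (u ⟨$⟩ˡ j) s) (tw T (u ⟨$⟩ˡ j) (swap₂ s))

swap₂-injective : ∀ {s s′} → swap₂ s ≡ swap₂ s′ → s ≡ s′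
swap₂-injective {s} {s′} e = trans (sym (swap₂-inv s)) (trans (cong swap₂ e) (swap₂-inv s′))

swap₂-≢ : ∀ s → swap₂ s ≢ s
swap₂-≢ zero ()
swap₂-≢ (suc zero) ()

-- A permutation in W(S_{2m}) sends each block {combine i 0, combine i 1} of positions onto a block of values.
module Blocks {m} (v : Perm (m * 2)) (v∈W : InW v) where

  adjacent-values : ∀ (j : Fin m) (s : Fin 2) → ∣ toℕ (v ⟨$⟩ˡ combine j s) - toℕ (v ⟨$⟩ˡ combine j (swap₂ s)) ∣ ≤ 1
  adjacent-values j zero = v∈W (combine j zero) (combine j (suc zero))
    (subst (_< m * 2) (sym (trans (cong suc (toℕ-combine-0 j)) (sym (toℕ-combine-1 j)))) (toℕ<n (combine j (suc zero))))
    (trans (cong suc (toℕ-combine-1 j)) (sym (trans (cong (star (m * 2) ∘ suc) (toℕ-combine-0 j))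
      (star-suc-dbl (m * 2) (toℕ j) (subst (_≤ m * 2) (cong suc (toℕ-combine-1 j)) (toℕ<n (combine j (suc zero))))))))
  adjacent-values j (suc zero) = subst (_≤ 1) (∣-∣-comm (toℕ (v ⟨$⟩ˡ combine j zero)) _) (adjacent-values j zero)

  Paired : Fin m → Set
  Paired i = ∀ (j : Fin m) (s : Fin 2) → v ⟨$⟩ʳ combine i zero ≡ combine j s → v ⟨$⟩ʳ combine i (suc zero) ≡ combine j (swap₂ s)

  -- The partner value sits next to combine i 0; it cannot sit just below, so it sits at combine i 1.
  paired-unless-below : ∀ (i j : Fin m) (s : Fin 2) → v ⟨$⟩ʳ combine i zero ≡ combine j s →
    (∀ y → suc (toℕ y) ≡ toℕ (combine i zero) → v ⟨$⟩ʳ y ≢ combine j (swap₂ s)) →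
    v ⟨$⟩ʳ combine i (suc zero) ≡ combine j (swap₂ s)
  paired-unless-below i j s vi≡js not-below with ∣-∣≤1⇒adjacent (toℕ (combine i zero)) (toℕ y) adjacent y≢i0
    where
    y = v ⟨$⟩ˡ combine j (swap₂ s)
    adjacent = subst (λ x → ∣ toℕ x - toℕ y ∣ ≤ 1) (trans (cong (v ⟨$⟩ˡ_) (sym vi≡js)) (inverseˡ v)) (adjacent-values j s)
    y≢i0 : toℕ y ≢ toℕ (combine i zero)
    y≢i0 y≡i0 = swap₂-≢ s (proj₂ (combine-injective j (swap₂ s) j s
      (trans (sym (inverseʳ v)) (trans (cong (v ⟨$⟩ʳ_) (toℕ-injective y≡i0)) vi≡js))))
  ... | inj₁ y≡i0+1 = trans (cong (v ⟨$⟩ʳ_) (toℕ-injective (trans (toℕ-combine-1 i) (trans (cong suc (sym (toℕ-combine-0 i))) (sym y≡i0+1))))) (inverseʳ v)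
  ... | inj₂ y+1≡i0 = ⊥-elim (not-below _ y+1≡i0 (inverseʳ v))

  paired : ∀ n (i : Fin m) → toℕ i ≡ n → Paired i
  paired n i i≡n j s vi≡js = paired-unless-below i j s vi≡js (not-below n i≡n)
    where
    not-below : ∀ n → toℕ i ≡ n → ∀ y → suc (toℕ y) ≡ toℕ (combine i zero) → v ⟨$⟩ʳ y ≢ combine j (swap₂ s)
    not-below zero i≡0 y y+1≡i0 _ = 1+n≢0 (trans y+1≡i0 (trans (toℕ-combine-0 i) (cong dbl i≡0)))
    not-below (suc n) i≡n+1 y y+1≡i0 vy≡js′ = from-block (combine-surjective {m} {2} (v ⟨$⟩ʳ combine i′ zero))
      where
      n<m : n < m
      n<m = <-trans (n<1+n n) (subst (_< m) i≡n+1 (toℕ<n i))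
      i′ : Fin m
      i′ = fromℕ< n<m
      i′≡n : toℕ i′ ≡ n
      i′≡n = toℕ-fromℕ< n<m
      y≡i′1 : y ≡ combine i′ (suc zero)
      y≡i′1 = toℕ-injective (suc-injective (begin
        suc (toℕ y)                   ≡⟨ y+1≡i0 ⟩
        toℕ (combine i zero)          ≡⟨ toℕ-combine-0 i ⟩
        dbl (toℕ i)                   ≡⟨ cong dbl (trans i≡n+1 (cong suc (sym i′≡n))) ⟩
        suc (suc (dbl (toℕ i′)))      ≡⟨ cong suc (toℕ-combine-1 i′) ⟨
        suc (toℕ (combine i′ (suc zero))) ∎))
        where open ≡-Reasoning
      from-block : ∃₂ (λ j′ s′ → combine j′ s′ ≡ v ⟨$⟩ʳ combine i′ zero) → ⊥
      from-block (j′ , s′ , j′s′≡vi′0) = <-irrefl (trans (sym i′≡n) (trans (cong toℕ i′≡i) i≡n+1)) (n<1+n n)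
        where
        same-partner : combine j′ (swap₂ s′) ≡ combine j (swap₂ s)
        same-partner = trans (sym (paired n i′ i′≡n j′ s′ (sym j′s′≡vi′0))) (trans (cong (v ⟨$⟩ʳ_) (sym y≡i′1)) vy≡js′)
        i′≡i : i′ ≡ i
        i′≡i = proj₁ (combine-injective i′ zero i zero (perm-injective v (begin
          v ⟨$⟩ʳ combine i′ zero   ≡⟨ j′s′≡vi′0 ⟨
          combine j′ s′           ≡⟨ cong₂ combine (proj₁ (combine-injective j′ (swap₂ s′) j (swap₂ s) same-partner))
                                        (swap₂-injective (proj₂ (combine-injective j′ (swap₂ s′) j (swap₂ s) same-partner))) ⟩
          combine j s             ≡⟨ vi≡js ⟨
          v ⟨$⟩ʳ combine i zero    ∎)))
          where open ≡-Reasoning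

  private
    target : ∀ (i : Fin m) → ∃₂ λ j s → combine j s ≡ v ⟨$⟩ʳ combine i zero
    target i = combine-surjective {m} {2} (v ⟨$⟩ʳ combine i zero)
    source : ∀ (j : Fin m) → ∃₂ λ i r → combine i r ≡ v ⟨$⟩ˡ combine j zero
    source j = combine-surjective {m} {2} (v ⟨$⟩ˡ combine j zero)

    flipped : Fin 2 → Bool
    flipped zero = false
    flipped (suc zero) = true

  image : Fin m → Fin m
  image i = proj₁ (target i)

  flips : Subset m
  flips = tabulate (λ i → flipped (proj₁ (proj₂ (target i))))

  v-combine : ∀ i r → v ⟨$⟩ʳ combine i r ≡ combine (image i) (tw flips i r)
  v-combine i r = begin
    v ⟨$⟩ʳ combine i r                    ≡⟨ on-block r ⟩
    combine (image i) (flip-by s r)       ≡⟨ cong (λ b → combine (image i) (if b then swap₂ r else r)) (lookup∘tabulate _ i) ⟨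
    combine (image i) (tw flips i r)      ∎
    where
    open ≡-Reasoning
    s = proj₁ (proj₂ (target i))
    vi0≡ : v ⟨$⟩ʳ combine i zero ≡ combine (image i) s
    vi0≡ = sym (proj₂ (proj₂ (target i)))
    flip-by : Fin 2 → Fin 2 → Fin 2
    flip-by s r = if flipped s then swap₂ r else r
    flip-by-zero : ∀ s → flip-by s zero ≡ s
    flip-by-zero zero = refl
    flip-by-zero (suc zero) = refl
    flip-by-one : ∀ s → flip-by s (suc zero) ≡ swap₂ s
    flip-by-one zero = refl
    flip-by-one (suc zero) = refl
    on-block : ∀ r → v ⟨$⟩ʳ combine i r ≡ combine (image i) (flip-by s r)
    on-block zero = trans vi0≡ (cong (combine (image i)) (sym (flip-by-zero s)))
    on-block (suc zero) = trans (paired (toℕ i) i refl (image i) s vi0≡) (cong (combine (image i)) (sym (flip-by-one s)))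

  preimage : Fin m → Fin m
  preimage j = proj₁ (source j)

  image-preimage : ∀ j → image (preimage j) ≡ j
  image-preimage j = proj₁ (combine-injective (image i) (tw flips i r) j zero (begin
    combine (image i) (tw flips i r)   ≡⟨ v-combine i r ⟨
    v ⟨$⟩ʳ combine i r                  ≡⟨ cong (v ⟨$⟩ʳ_) (proj₂ (proj₂ (source j))) ⟩
    v ⟨$⟩ʳ (v ⟨$⟩ˡ combine j zero)       ≡⟨ inverseʳ v ⟩
    combine j zero                     ∎))
    where
    open ≡-Reasoning
    i = proj₁ (source j)
    r = proj₁ (proj₂ (source j))

  preimage-image : ∀ i → preimage (image i) ≡ i
  preimage-image i = proj₁ (combine-injective (preimage (image i)) r i (tw flips i zero) (begin
    combine (preimage (image i)) r                 ≡⟨ proj₂ (proj₂ (source (image i))) ⟩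
    v ⟨$⟩ˡ combine (image i) zero                   ≡⟨ cong (λ t → v ⟨$⟩ˡ combine (image i) t) (tw-inv flips i zero) ⟨
    v ⟨$⟩ˡ combine (image i) (tw flips i (tw flips i zero)) ≡⟨ cong (v ⟨$⟩ˡ_) (v-combine i (tw flips i zero)) ⟨
    v ⟨$⟩ˡ (v ⟨$⟩ʳ combine i (tw flips i zero))     ≡⟨ inverseˡ v ⟩
    combine i (tw flips i zero)                    ∎))
    where
    open ≡-Reasoning
    r = proj₁ (proj₂ (source (image i)))

  shape : Perm m
  shape = permutation image preimage image-preimage preimage-image

  ψ-shape-flips : ψ shape flips ≈ₚ v
  ψ-shape-flips x with combine-surjective {m} {2} x
  ... | i , r , refl = trans (ψ-combine shape flips i r) (sym (v-combine i r))

ψ-surjective : ∀ (v : Perm (m * 2)) → InW v → Σ[ u ∈ Perm m ] Σ[ T ∈ Subset m ] (ψ u T ≈ₚ v)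
ψ-surjective {m} v v∈W = shape , flips , ψ-shape-flips
  where open Blocks {m} v v∈W

-- Length and ranks of ψ(u, T)

∣∣≡sum-lookup : ∀ (T : Subset m) → ∣ T ∣ ≡ ∑[ i < m ] 𝟙 (lookup T i)
∣∣≡sum-lookup [] = refl
∣∣≡sum-lookup (true ∷ T) = cong suc (∣∣≡sum-lookup T)
∣∣≡sum-lookup (false ∷ T) = ∣∣≡sum-lookup T

inversions-ψ : ∀ (u : Perm m) (T : Subset m) → inversions (ψ u T) ≡ 4 * inversions u + ∣ T ∣
inversions-ψ {m} u T = begin
  inversions (ψ u T)                                                 ≡⟨ sum-combine {m} (λ x → sum (H x)) ⟩
  ∑[ i < m ] (sum (H (combine i zero)) + sum (H (combine i (suc zero))))
    ≡⟨ sum-cong-≗ {m} (λ i → trans (cong₂ _+_ (sum-combine {m} (H (combine i zero))) (sum-combine {m} (H (combine i (suc zero)))))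
                                  (sym (∑-distrib-+ {m} (λ j → H (combine i zero) (combine j zero) + H (combine i zero) (combine j (suc zero)))
                                                         (λ j → H (combine i (suc zero)) (combine j zero) + H (combine i (suc zero)) (combine j (suc zero)))))) ⟩
  ∑[ i < m ] sum (B i)                                               ≡⟨ sum-cong-≗ {m} row ⟩
  ∑[ i < m ] (𝟙 (lookup T i) + 4 * sum (D i))                        ≡⟨ ∑-distrib-+ {m} (λ i → 𝟙 (lookup T i)) (λ i → 4 * sum (D i)) ⟩
  ∑[ i < m ] 𝟙 (lookup T i) + ∑[ i < m ] (4 * sum (D i))             ≡⟨ cong₂ _+_ (∣∣≡sum-lookup T) (*-distribˡ-sum {m} 4 (λ i → sum (D i))) ⟨
  ∣ T ∣ + 4 * inversions u                                           ≡⟨ +-comm ∣ T ∣ _ ⟩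
  4 * inversions u + ∣ T ∣                                           ∎
  where
  open ≡-Reasoning
  H : Fin (m * 2) → Fin (m * 2) → ℕ
  H x y = ⟦ toℕ x < toℕ y ⟧ * ⟦ val (ψ u T) y < val (ψ u T) x ⟧
  B D : Fin m → Fin m → ℕ
  B i j = (H (combine i zero) (combine j zero) + H (combine i zero) (combine j (suc zero)))
        + (H (combine i (suc zero)) (combine j zero) + H (combine i (suc zero)) (combine j (suc zero)))
  D i j = ⟦ toℕ i < toℕ j ⟧ * ⟦ val u j < val u i ⟧
  H-block : ∀ i j r s → H (combine i r) (combine j s)
    ≡ ⟦ dbl (toℕ i) + toℕ r < dbl (toℕ j) + toℕ s ⟧ * ⟦ dbl (val u j) + toℕ (tw T j s) < dbl (val u i) + toℕ (tw T i r) ⟧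
  H-block i j r s = cong₂ _*_ (cong₂ ⟦_<_⟧ (toℕ-combine₂ i r) (toℕ-combine₂ j s)) (cong₂ ⟦_<_⟧ (val-ψ u T j s) (val-ψ u T i r))
  H-off : ∀ {i j} r s → i ≢ j → H (combine i r) (combine j s) ≡ D i j
  H-off {i} {j} r s i≢j = trans (H-block i j r s)
    (cong₂ _*_ (⟦dbl+<dbl+⟧-≢ r s (i≢j ∘ toℕ-injective))
               (⟦dbl+<dbl+⟧-≢ (tw T j s) (tw T i r) (i≢j ∘ sym ∘ perm-injective u ∘ toℕ-injective)))
  H-diag : ∀ i r s → H (combine i r) (combine i s) ≡ ⟦ toℕ r < toℕ s ⟧ * ⟦ toℕ (tw T i s) < toℕ (tw T i r) ⟧
  H-diag i r s = trans (H-block i i r s)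
    (cong₂ _*_ (⟦dbl+<dbl+⟧-≡ (toℕ i) (toℕ r) (toℕ s)) (⟦dbl+<dbl+⟧-≡ (val u i) (toℕ (tw T i s)) (toℕ (tw T i r))))
  B-diag : ∀ i → B i i ≡ 𝟙 (lookup T i)
  B-diag i rewrite H-diag i zero zero | H-diag i zero (suc zero) | H-diag i (suc zero) zero | H-diag i (suc zero) (suc zero)
    with lookup T i
  ... | true = refl
  ... | false = refl
  B-off : ∀ i j → j ≢ i → B i j ≡ 4 * D i j
  B-off i j j≢i rewrite H-off zero zero (j≢i ∘ sym) | H-off zero (suc zero) (j≢i ∘ sym)
                      | H-off (suc zero) zero (j≢i ∘ sym) | H-off (suc zero) (suc zero) (j≢i ∘ sym) =
    solve 1 (λ x → (x :+ x) :+ (x :+ x) := con 4 :* x) refl (D i j)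
    where open +-*-Solver
  row : ∀ i → sum (B i) ≡ 𝟙 (lookup T i) + 4 * sum (D i)
  row i = begin
    sum (B i)                                            ≡⟨ sum-zeroAt i (B i) ⟩
    B i i + sum (zeroAt i (B i))                         ≡⟨ cong₂ _+_ (B-diag i) (sum-cong-≗ {m} (zeroAt-cong i (B-off i))) ⟩
    𝟙 (lookup T i) + sum (zeroAt i (λ j → 4 * D i j))    ≡⟨ cong (𝟙 (lookup T i) +_) four-rows ⟨
    𝟙 (lookup T i) + 4 * sum (D i)                       ∎
    where
    Dii≡0 : 4 * D i i ≡ 0
    Dii≡0 rewrite ⟦<⟧-irrefl (toℕ i) = refl
    four-rows : 4 * sum (D i) ≡ sum (zeroAt i (λ j → 4 * D i j))
    four-rows = trans (*-distribˡ-sum {m} 4 (D i)) (trans (sum-zeroAt i (λ j → 4 * D i j)) (cong (_+ sum (zeroAt i (λ j → 4 * D i j))) Dii≡0))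

ℓ-ψ : ∀ (u : Perm m) (T : Subset m) → ℓ (ψ u T) ≡ 4 * ℓ u + ∣ T ∣
ℓ-ψ u T = trans (ℓ≡inversions (ψ u T)) (trans (inversions-ψ u T) (cong (λ n → 4 * n + ∣ T ∣) (sym (ℓ≡inversions u))))

tw-suc : ∀ (T : Subset m) i → tw T i (suc zero) ≡ swap₂ (tw T i zero)
tw-suc T i with lookup T i
... | true = refl
... | false = refl

toℕ-tw-zero : ∀ (T : Subset m) i → toℕ (tw T i zero) ≡ 𝟙 (lookup T i)
toℕ-tw-zero T i with lookup T i
... | true = refl
... | false = refl

⟦+⟦<⟧<suc⟧-swap₂ : ∀ β x (σ t : Fin 2) →
  ⟦ β + ⟦ toℕ t < toℕ σ ⟧ < suc x ⟧ + ⟦ β + ⟦ toℕ (swap₂ t) < toℕ σ ⟧ < suc x ⟧ ≡ ⟦ β + toℕ σ < suc x ⟧ + ⟦ β < suc x ⟧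
⟦+⟦<⟧<suc⟧-swap₂ β x zero t rewrite +-identityʳ β = refl
⟦+⟦<⟧<suc⟧-swap₂ β x (suc zero) zero rewrite +-identityʳ β = refl
⟦+⟦<⟧<suc⟧-swap₂ β x (suc zero) (suc zero) rewrite +-identityʳ β = +-comm ⟦ β < suc x ⟧ _

rank-ψ-even : ∀ (u : Perm m) (T : Subset m) α β (σ : Fin 2) →
  rank (ψ u T) (dbl α) (dbl β + toℕ σ) ≡ rank u α (β + toℕ σ) + rank u α β
rank-ψ-even {m} u T α β σ = begin
  rank (ψ u T) (dbl α) b                                       ≡⟨ sum-combine {m} term ⟩
  ∑[ i < m ] (term (combine i zero) + term (combine i (suc zero))) ≡⟨ sum-cong-≗ {m} pair ⟩
  ∑[ i < m ] (⟦ toℕ i < α ⟧ * ⟦ β + toℕ σ < suc (val u i) ⟧ + ⟦ toℕ i < α ⟧ * ⟦ β < suc (val u i) ⟧)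
                                                               ≡⟨ ∑-distrib-+ {m} _ _ ⟩
  rank u α (β + toℕ σ) + rank u α β                            ∎
  where
  open ≡-Reasoning
  b = dbl β + toℕ σ
  term : Fin (m * 2) → ℕ
  term x = ⟦ toℕ x < dbl α ⟧ * ⟦ b < suc (val (ψ u T) x) ⟧
  term-combine : ∀ i r → term (combine i r) ≡ ⟦ toℕ i < α ⟧ * ⟦ β + ⟦ toℕ (tw T i r) < toℕ σ ⟧ < suc (val u i) ⟧
  term-combine i r = cong₂ _*_ (trans (cong (⟦_< dbl α ⟧) (toℕ-combine₂ i r)) (⟦dbl+<dbl⟧ (toℕ i) α r))
                               (trans (cong (λ y → ⟦ b < suc y ⟧) (val-ψ u T i r)) (⟦dbl+≤dbl+⟧ β (val u i) σ (tw T i r)))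
  pair : ∀ i → term (combine i zero) + term (combine i (suc zero))
             ≡ ⟦ toℕ i < α ⟧ * ⟦ β + toℕ σ < suc (val u i) ⟧ + ⟦ toℕ i < α ⟧ * ⟦ β < suc (val u i) ⟧
  pair i = begin
    term (combine i zero) + term (combine i (suc zero))
      ≡⟨ cong₂ _+_ (term-combine i zero) (trans (term-combine i (suc zero)) (cong (λ t → ⟦ toℕ i < α ⟧ * ⟦ β + ⟦ toℕ t < toℕ σ ⟧ < suc (val u i) ⟧) (tw-suc T i))) ⟩
    P * ⟦ β + ⟦ toℕ t < toℕ σ ⟧ < suc x ⟧ + P * ⟦ β + ⟦ toℕ (swap₂ t) < toℕ σ ⟧ < suc x ⟧
      ≡⟨ *-distribˡ-+ P _ _ ⟨
    P * (⟦ β + ⟦ toℕ t < toℕ σ ⟧ < suc x ⟧ + ⟦ β + ⟦ toℕ (swap₂ t) < toℕ σ ⟧ < suc x ⟧)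
      ≡⟨ cong (P *_) (⟦+⟦<⟧<suc⟧-swap₂ β x σ t) ⟩
    P * (⟦ β + toℕ σ < suc x ⟧ + ⟦ β < suc x ⟧)
      ≡⟨ *-distribˡ-+ P _ _ ⟩
    P * ⟦ β + toℕ σ < suc x ⟧ + P * ⟦ β < suc x ⟧ ∎
    where
    P = ⟦ toℕ i < α ⟧
    t = tw T i zero
    x = val u i

rank-ψ-odd : ∀ (u : Perm m) (T : Subset m) (i : Fin m) β (σ : Fin 2) →
  rank (ψ u T) (suc (dbl (toℕ i))) (dbl β + toℕ σ)
    ≡ rank u (toℕ i) (β + toℕ σ) + rank u (toℕ i) β + ⟦ β + ⟦ toℕ (tw T i zero) < toℕ σ ⟧ < suc (val u i) ⟧
rank-ψ-odd u T i β σ = begin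
  rank (ψ u T) (suc (dbl (toℕ i))) b                               ≡⟨ cong (λ a → rank (ψ u T) (suc a) b) (toℕ-combine-0 i) ⟨
  rank (ψ u T) (suc (toℕ (combine i zero))) b                      ≡⟨ rank-suc (ψ u T) (combine i zero) b ⟩
  rank (ψ u T) (toℕ (combine i zero)) b + ⟦ b < suc (val (ψ u T) (combine i zero)) ⟧
    ≡⟨ cong₂ _+_ (trans (cong (λ a → rank (ψ u T) a b) (toℕ-combine-0 i)) (rank-ψ-even u T (toℕ i) β σ))
                 (trans (cong (λ y → ⟦ b < suc y ⟧) (val-ψ u T i zero)) (⟦dbl+≤dbl+⟧ β (val u i) σ (tw T i zero))) ⟩
  rank u (toℕ i) (β + toℕ σ) + rank u (toℕ i) β + ⟦ β + ⟦ toℕ (tw T i zero) < toℕ σ ⟧ < suc (val u i) ⟧ ∎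
  where
  open ≡-Reasoning
  b = dbl β + toℕ σ

-- Comparison of one odd row of the rank functions of ψ u T and ψ u′ T′, where A, A′ are the rank rows
-- of u, u′ just before the block and x, x′ the values of u, u′ at the block.
odd-row-≤ : ∀ {A A′ : ℕ → ℕ} {x x′} β (σ : Fin 2) {t t′ : Fin 2} →
  (∀ c → A c ≤ A′ c) → (∀ c → A c + ⟦ c < suc x ⟧ ≤ A′ c + ⟦ c < suc x′ ⟧) → toℕ t ≤ toℕ t′ →
  A (β + toℕ σ) + A β + ⟦ β + ⟦ toℕ t < toℕ σ ⟧ < suc x ⟧ ≤ A′ (β + toℕ σ) + A′ β + ⟦ β + ⟦ toℕ t′ < toℕ σ ⟧ < suc x′ ⟧
odd-row-≤ {A} {A′} {x} {x′} β zero row≤ next≤ _ rewrite +-identityʳ β =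
  +-mono-≤-split₁₃ {a = A β} {c = ⟦ β < suc x ⟧} {a′ = A′ β} {c′ = ⟦ β < suc x′ ⟧} (next≤ β) (row≤ β)
odd-row-≤ {A} {A′} {x} {x′} β (suc zero) {zero} {zero} row≤ next≤ _ =
  +-mono-≤-split₁₃ {a = A (β + 1)} {c = ⟦ β + 1 < suc x ⟧} {a′ = A′ (β + 1)} {c′ = ⟦ β + 1 < suc x′ ⟧} (next≤ (β + 1)) (row≤ β)
odd-row-≤ {A} {A′} {x} {x′} β (suc zero) {zero} {suc zero} row≤ next≤ _ rewrite +-identityʳ β =
  ≤-trans (+-monoʳ-≤ (A (β + 1) + A β) (⊑⇒≤ (⟦<⟧-antiˡ {suc x} (m≤m+n β 1))))
          (+-mono-≤-split₁₂₃ (row≤ (β + 1)) (next≤ β))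
odd-row-≤ {A} {A′} {x} {x′} β (suc zero) {suc zero} {suc zero} row≤ next≤ _ rewrite +-identityʳ β =
  +-mono-≤-split₁₂₃ (row≤ (β + 1)) (next≤ β)
odd-row-≤ β (suc zero) {suc zero} {zero} _ _ ()

⊆⇒lookup : ∀ {T T′ : Subset m} → T ⊆ T′ → ∀ i → lookup T i ≡ true → lookup T′ i ≡ true
⊆⇒lookup {T = T} {T′} T⊆T′ i Ti = []=⇒lookup (T⊆T′ (lookup⇒[]= i T Ti))

ψ-mono : ∀ {u u′ : Perm m} {T T′ : Subset m} → u ⊴ u′ → T ⊆ T′ → ψ u T ⊴ ψ u′ T′
ψ-mono {m} {u} {u′} {T} {T′} u⊴u′ T⊆T′ a b with halve a | halve b
... | α , ρ , refl | β , σ , refl = row ρ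
  where
  R R′ : ℕ → ℕ
  R a = rank (ψ u T) a (dbl β + toℕ σ)
  R′ a = rank (ψ u′ T′) a (dbl β + toℕ σ)
  even : R (dbl α) ≤ R′ (dbl α)
  even = subst₂ _≤_ (sym (rank-ψ-even u T α β σ)) (sym (rank-ψ-even u′ T′ α β σ)) (+-mono-≤ (u⊴u′ α (β + toℕ σ)) (u⊴u′ α β))
  odd-inside : (i : Fin m) → R (suc (dbl (toℕ i))) ≤ R′ (suc (dbl (toℕ i)))
  odd-inside i = subst₂ _≤_ (sym (rank-ψ-odd u T i β σ)) (sym (rank-ψ-odd u′ T′ i β σ))
    (odd-row-≤ β σ (u⊴u′ (toℕ i)) (λ c → subst₂ _≤_ (rank-suc u i c) (rank-suc u′ i c) (u⊴u′ (suc (toℕ i)) c))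
      (subst₂ _≤_ (sym (toℕ-tw-zero T i)) (sym (toℕ-tw-zero T′ i)) (𝟙-mono (⊆⇒lookup T⊆T′ i))))
  odd : R (suc (dbl α)) ≤ R′ (suc (dbl α))
  odd with m ≤? α
  ... | yes m≤α = subst₂ _≤_ (sym (rank-beyond (ψ u T) (dbl α) (dbl β + toℕ σ) beyond)) (sym (rank-beyond (ψ u′ T′) (dbl α) (dbl β + toℕ σ) beyond)) even
    where beyond = subst (m * 2 ≤_) (*2≡dbl α) (*-monoˡ-≤ 2 m≤α)
  ... | no m≰α = subst (λ a → R (suc (dbl a)) ≤ R′ (suc (dbl a))) (toℕ-fromℕ< (≰⇒> m≰α)) (odd-inside (fromℕ< (≰⇒> m≰α)))
  row : ∀ ρ → R (dbl α + toℕ ρ) ≤ R′ (dbl α + toℕ ρ)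
  row zero = subst (λ a → R a ≤ R′ a) (sym (+-identityʳ (dbl α))) even
  row (suc zero) = subst (λ a → R a ≤ R′ a) (+-comm 1 (dbl α)) odd

ψ-reflects-⊴ : ∀ {u u′ : Perm m} {T T′ : Subset m} → ψ u T ⊴ ψ u′ T′ → u ⊴ u′
ψ-reflects-⊴ {u = u} {u′} {T} {T′} ψ⊴ψ′ α β = m+m≤n+n⇒m≤n (subst₂ _≤_ (even-row u T) (even-row u′ T′) (ψ⊴ψ′ (dbl α) (dbl β + 0)))
  where
  even-row : ∀ w S → rank (ψ w S) (dbl α) (dbl β + 0) ≡ rank w α β + rank w α β
  even-row w S = trans (rank-ψ-even w S α β zero) (cong (λ c → rank w α c + rank w α β) (+-identityʳ β))

-- Along the odd row through block i, at the threshold just above u i, the ranks of ψ u T exceed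
-- those of ψ u T′ by one if i ∈ T but i ∉ T′.
ψ-reflects-⊆ : ∀ {u u′ : Perm m} {T T′ : Subset m} → u ≈ₚ u′ → ψ u T ⊴ ψ u′ T′ → T ⊆ T′
ψ-reflects-⊆ {u = u} {u′} {T} {T′} u≈u′ ψ⊴ψ′ {i} i∈T with lookup T′ i in T′i
... | true = lookup⇒[]= i T′ T′i
... | false = ⊥-elim (1+n≰n (subst₂ _≤_ (trans lhs (+-comm X 1)) rhs (ψ⊴ψ′ (suc (dbl (toℕ i))) (dbl β + 1))))
  where
  β = val u i
  X = rank u (toℕ i) (β + 1) + rank u (toℕ i) β
  lhs : rank (ψ u T) (suc (dbl (toℕ i))) (dbl β + 1) ≡ X + 1
  lhs rewrite rank-ψ-odd u T i β (suc zero) | toℕ-tw-zero T i | []=⇒lookup i∈T | +-identityʳ β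
            | <⇒⟦<⟧≡1 (n<1+n β) = refl
  rhs : rank (ψ u′ T′) (suc (dbl (toℕ i))) (dbl β + 1) ≡ X
  rhs rewrite rank-ψ-odd u′ T′ i β (suc zero) | toℕ-tw-zero T′ i | T′i | sym (cong toℕ (u≈u′ i))
            | ≥⇒⟦<⟧≡0 (≤-reflexive (+-comm 1 β)) | +-identityʳ (rank u′ (toℕ i) (β + 1) + rank u′ (toℕ i) β)
            | rank-cong {u = u′} {u} (λ p → sym (u≈u′ p)) (toℕ i) (β + 1) | rank-cong {u = u′} {u} (λ p → sym (u≈u′ p)) (toℕ i) β = refl

ψ-reflects-≤⊗ : ∀ {u u′ : Perm m} {T T′ : Subset m} → ψ u T ⊴ ψ u′ T′ → (u , T) ≤⊗ (u′ , T′)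
ψ-reflects-≤⊗ {u = u} {u′} {T} {T′} ψ⊴ψ′ with first-difference u u′
... | inj₁ u≈u′ = inj₂ (u≈u′ , ψ-reflects-⊆ {u = u} {u′} {T} {T′} u≈u′ ψ⊴ψ′)
... | inj₂ (p , up≢u′p , _) = inj₁ (⊴⇒≤B {u = u} {u′} (ψ-reflects-⊴ {u = u} {u′} {T} {T′} ψ⊴ψ′) , λ u≈u′ → up≢u′p (u≈u′ p))

ψ-mono-≤B : ∀ {u u′ : Perm m} {T T′ : Subset m} → (u , T) ≤× (u′ , T′) → ψ u T ≤B ψ u′ T′
ψ-mono-≤B {u = u} {u′} {T} {T′} (u≤u′ , T⊆T′) =
  ⊴⇒≤B {u = ψ u T} {ψ u′ T′} (ψ-mono {u = u} {u′} {T} {T′} (≤B⇒⊴ {u = u} {u′} u≤u′) T⊆T′)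

proposition3p2 : (m : ℕ) → 1 ≤ m →
    -- (1) ψ is a bijection onto W(S_{2m})
    ((∀ (u : Perm m) (T : Subset m) → InW (ψ u T))
     × (∀ (u u' : Perm m) (T T' : Subset m) → ψ u T ≈ₚ ψ u' T' → (u ≈ₚ u') × (T ≡ T'))
     × (∀ (v : Perm (m * 2)) → InW v → Σ[ u ∈ Perm m ] Σ[ T ∈ Subset m ] (ψ u T ≈ₚ v)))
    -- (2) φ_{2m} = ψ⁻¹ : W(S_{2m}) → S_m ⊗ P([m]) is order preserving
    × (∀ (u u' : Perm m) (T T' : Subset m) → ψ u T ≤B ψ u' T' → (u , T) ≤⊗ (u' , T'))
    -- (3) ψ : S_m × P([m]) → W(S_{2m}) is order preserving (product order)
    × (∀ (u u' : Perm m) (T T' : Subset m) → (u , T) ≤× (u' , T') → ψ u T ≤B ψ u' T')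
    -- length formula: ℓ(v) = 4ℓ(τ) + |T| for v = ψ(τ, T), i.e. φ_{2m}(v) = (τ, T)
    × (∀ (τ : Perm m) (T : Subset m) → ℓ (ψ τ T) ≡ 4 * ℓ τ + ∣ T ∣)
proposition3p2 m _ =
  (ψ-InW , ψ-injective , ψ-surjective)
  , (λ u u′ T T′ → ψ-reflects-≤⊗ {u = u} {u′} {T} {T′} ∘ ≤B⇒⊴ {u = ψ u T} {ψ u′ T′})
  , (λ u u′ T T′ → ψ-mono-≤B {u = u} {u′} {T} {T′})
  , ℓ-ψ
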